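{- Let $k$ and $M$ be positive integers, and let $M=p_{1}^{e_{1}}p_{2}^{e_{2}}\cdots p_{l}^{e_{l}}$ be the prime factorization of $M$, where $p_1,\dots,p_l$ are distinct primes. For any integers $n,m\geq \max\{e_j \mid 1\leq j\leq l\}$ satisfying $n\equiv m \pmod{\varphi(M)}$, we have \[ L(k,n)\equiv L(k,m)\pmod{M}. \]
   Context: A matrix with all entries in $\{0,1\}$ is called lonesum if it is uniquely determined (among $0$-$1$ matrices of the same size) by its vector of row sums and its vector of column sums. For positive integers $k,n$, $L(k,n)$ denotes the number of lonesum matrices of size $k\times n$. $\varphi$ denotes Euler's totient function. -}

module Defs where

open import Data.Bool using (Bool; true; false; if_then_else_)
open import Data.Nat using (ℕ; zero; suc; _+_)
open import Data.Nat.GCD using (gcd)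
open import Data.Nat.Properties as ℕP using ()
open import Data.List as List using (List; []; _∷_; filter; length; concatMap)
open import Data.Vec as Vec using (Vec; []; _∷_; transpose)
open import Data.Vec.Properties using (≡-dec)
open import Relation.Nullary using (Dec; yes; no; ¬_)
open import Relation.Nullary.Decidable using (_→-dec_)
open import Relation.Binary.PropositionalEquality using (_≡_; refl)

Matrix : ℕ → ℕ → Set
Matrix k n = Vec (Vec Bool n) k

bit : Bool → ℕ
bit b = if b then 1 else 0

bitSum : ∀ {n} → Vec Bool n → ℕ
bitSum v = Vec.sum (Vec.map bit v)

rowSums : ∀ {k n} → Matrix k n → Vec ℕ k
rowSums A = Vec.map bitSum A

colSums : ∀ {k n} → Matrix k n → Vec ℕ n
colSums A = Vec.map bitSum (transpose A)

Lonesum : ∀ {k n} → Matrix k n → Set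
Lonesum {k} {n} A =
  (B : Matrix k n) → rowSums B ≡ rowSums A → colSums B ≡ colSums A → B ≡ A

Searchable : Set → Set₁
Searchable A = (P : A → Set) → (∀ x → Dec (P x)) → Dec (∀ x → P x)

searchBool : Searchable Bool
searchBool P d with d false | d true
... | yes pf | yes pt = yes λ { false → pf ; true → pt }
... | no ¬pf | _ = no λ h → ¬pf (h false)
... | yes _ | no ¬pt = no λ h → ¬pt (h true)

searchVec : ∀ {A} → Searchable A → (n : ℕ) → Searchable (Vec A n)
searchVec sA zero P d with d []
... | yes p = yes λ { [] → p }
... | no ¬p = no λ h → ¬p (h [])
searchVec sA (suc n) P d
  with sA (λ x → ∀ xs → P (x ∷ xs))
          (λ x → searchVec sA n (λ xs → P (x ∷ xs)) (λ xs → d (x ∷ xs)))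
... | yes h = yes λ { (x ∷ xs) → h x xs }
... | no ¬h = no λ h → ¬h (λ x xs → h (x ∷ xs))

lonesum? : ∀ {k n} (A : Matrix k n) → Dec (Lonesum A)
lonesum? {k} {n} A =
  searchVec (searchVec searchBool n) k _
    (λ B → ≡-dec ℕP._≟_ (rowSums B) (rowSums A) →-dec
           (≡-dec ℕP._≟_ (colSums B) (colSums A) →-dec
            ≡-dec (≡-dec Data.Bool._≟_) B A))
  where import Data.Bool

allVecs : ∀ {A : Set} → List A → (n : ℕ) → List (Vec A n)
allVecs xs zero = [] ∷ []
allVecs xs (suc n) = concatMap (λ x → List.map (x ∷_) (allVecs xs n)) xs

allMatrices : (k n : ℕ) → List (Matrix k n)
allMatrices k n = allVecs (allVecs (false ∷ true ∷ []) n) k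

L : ℕ → ℕ → ℕ
L k n = length (filter lonesum? (allMatrices k n))

φ : ℕ → ℕ
φ M = length (filter (λ i → gcd i M ℕP.≟ 1) (List.map suc (List.upTo M)))

-- A 0-1 matrix is lonesum exactly when its columns form a chain under inclusion: then the
-- column sums determine, row by row, where the ones sit; otherwise some 2 × 2 submatrix
-- [1 0; 0 1] can have its ones and zeros exchanged. So L(k, n) counts the n-tuples of pairwise
-- comparable vectors in {0,1}^k. Classifying such tuples by the positions of one fixed vector,
-- induction on the set of allowed vectors shows that n ↦ L(k, n) is a difference of power sums
-- ∑ bⁿ − ∑ cⁿ. It remains to see that b^(n + φ(M)) ≡ bⁿ (mod M) once n bounds every exponent
-- in M: write M = M′ g with g = gcd(bⁿ, M), which divides bⁿ, while b is a unit modulo M′,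
-- and apply Euler's theorem.
module Submission where

open import Data.Bool as Bool using (Bool; true; false; _∧_)
open import Data.Bool.ListAction using (all)
open import Data.Bool.Properties using (∧-assoc; ∧-idem; ∧-comm; T-≡; ≤-minimum; ⇔→≡)
open import Data.Empty using (⊥)
open import Data.Fin using (Fin; zero; suc)
open import Data.Fin.Properties using (_≟_; ¬∀⟶∃¬; all?)
import Data.Fin.Permutation as Perm
import Data.Fin.Permutation.Components as PC
open import Data.List as List using (List; []; _∷_; _++_; concatMap; length; filter; upTo)
open import Data.List.Membership.Propositional using (_∈_)
open import Data.List.Membership.Propositional.Properties
  using (∈-filter⁻; ∈-filter⁺; ∈-map⁻; ∈-map⁺; ∈-upTo⁻; ∈-upTo⁺)
open import Data.List.Membership.Propositional.Properties.WithK using (unique∧set⇒bag)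
open import Data.List.Relation.Binary.BagAndSetEquality using (∼bag⇒↭)
open import Data.List.Relation.Binary.Permutation.Propositional using (_↭_)
import Data.List.Relation.Unary.All as All
import Data.List.Relation.Unary.All.Properties as All
open import Data.List.Relation.Unary.Any using (here; there)
import Data.List.Relation.Unary.AllPairs as AllPairs
open import Data.List.Relation.Unary.Unique.Propositional using (Unique)
import Data.List.Relation.Unary.Unique.Propositional.Properties as Unique
open import Data.Nat hiding (_≟_)
open import Data.Nat.Properties hiding (_≟_)
import Data.Nat.Properties as ℕ using (_≟_)
open import Algebra.Properties.Semiring.Sum +-*-semiring
  using (sum; sum-syntax; ∑-comm; *-distribˡ-sum; sum-cong-≗; sum-permute)
open import Data.Nat.Coprimality as Coprimality using (Coprime; coprime-Bézout; coprime-divisor)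
open import Data.Nat.Divisibility
open import Data.Nat.DivMod using (_%_; _/_; m≡m%n+[m/n]*n; m%n<n)
open import Data.Nat.GCD using (gcd; gcd[m,n]∣m; gcd[m,n]∣n; gcd-greatest; module Bézout)
open import Data.Nat.ListAction using (product)
open import Data.Nat.ListAction.Properties using (product-↭)
open import Data.Nat.Primality using (Prime)
open import Data.Nat.Primality.Factorisation using (factorise)
open import Data.Nat.Tactic.RingSolver using (solve-∀)
open import Data.Product using (∃; ∃₂; _×_; _,_; proj₁; proj₂)
open import Data.Sum as Sum using (_⊎_; inj₁; inj₂)
open import Data.Vec as Vec using (Vec; []; _∷_; lookup; tabulate; transpose; replicate; zipWith; _⊛_)
open import Data.Vec.Properties
  using (lookup-⊛; lookup-replicate; lookup-map; lookup∘tabulate; tabulate∘lookup; tabulate-cong; zipWith-is-⊛)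
open import Function using (_∘_)
open import Function.Bundles using (_⇔_; mk⇔; Equivalence)
open import Relation.Nullary using (¬_; Dec; does; yes; no; contradiction; _⊎-dec_)
open import Relation.Nullary.Decidable using (dec-true)
open import Relation.Binary.PropositionalEquality
open import Defs
open ≡-Reasoning

private variable A B C D : Set

sumOver : List A → (A → ℕ) → ℕ
sumOver []       f = 0
sumOver (x ∷ xs) f = f x + sumOver xs f

syntax sumOver xs (λ x → e) = ∑[ x ← xs ] e

∑←-cong : ∀ (xs : List A) {f g : A → ℕ} → (∀ x → f x ≡ g x) → ∑[ x ← xs ] f x ≡ ∑[ x ← xs ] g x
∑←-cong []       f≗g = refl
∑←-cong (x ∷ xs) f≗g = cong₂ _+_ (f≗g x) (∑←-cong xs f≗g)

∑←-zero : ∀ (xs : List A) → ∑[ x ← xs ] 0 ≡ 0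
∑←-zero []       = refl
∑←-zero (x ∷ xs) = ∑←-zero xs

∑←-++ : ∀ (xs ys : List A) (f : A → ℕ) → ∑[ x ← xs ++ ys ] f x ≡ ∑[ x ← xs ] f x + ∑[ y ← ys ] f y
∑←-++ []       ys f = refl
∑←-++ (x ∷ xs) ys f = trans (cong (f x +_) (∑←-++ xs ys f)) (sym (+-assoc (f x) _ _))

∑←-distrib-+ : ∀ (xs : List A) (f g : A → ℕ) → ∑[ x ← xs ] (f x + g x) ≡ ∑[ x ← xs ] f x + ∑[ x ← xs ] g x
∑←-distrib-+ []       f g = refl
∑←-distrib-+ (x ∷ xs) f g = begin
  f x + g x + ∑[ y ← xs ] (f y + g y)           ≡⟨ cong (f x + g x +_) (∑←-distrib-+ xs f g) ⟩
  f x + g x + (∑[ y ← xs ] f y + ∑[ y ← xs ] g y) ≡⟨ +-+-comm (f x) (g x) _ _ ⟩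
  f x + ∑[ y ← xs ] f y + (g x + ∑[ y ← xs ] g y) ∎
  where
  +-+-comm : ∀ a b c d → a + b + (c + d) ≡ a + c + (b + d)
  +-+-comm = solve-∀

*-distribˡ-∑← : ∀ c (xs : List A) (f : A → ℕ) → c * ∑[ x ← xs ] f x ≡ ∑[ x ← xs ] (c * f x)
*-distribˡ-∑← c []       f = *-zeroʳ c
*-distribˡ-∑← c (x ∷ xs) f = trans (*-distribˡ-+ c (f x) _) (cong (c * f x +_) (*-distribˡ-∑← c xs f))

∑←-comm : ∀ (xs : List A) (ys : List B) (f : A → B → ℕ) →
          ∑[ x ← xs ] ∑[ y ← ys ] f x y ≡ ∑[ y ← ys ] ∑[ x ← xs ] f x y
∑←-comm []       ys f = sym (∑←-zero ys)
∑←-comm (x ∷ xs) ys f = trans (cong (∑[ y ← ys ] f x y +_) (∑←-comm xs ys f))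
                              (sym (∑←-distrib-+ ys (f x) _))

∑←-map : ∀ (g : A → B) (xs : List A) (f : B → ℕ) → ∑[ y ← List.map g xs ] f y ≡ ∑[ x ← xs ] f (g x)
∑←-map g []       f = refl
∑←-map g (x ∷ xs) f = cong (f (g x) +_) (∑←-map g xs f)

∑←-concatMap-map : ∀ (g : A → B → C) (xs : List A) (ys : List B) (f : C → ℕ) →
  ∑[ z ← concatMap (λ x → List.map (g x) ys) xs ] f z ≡ ∑[ x ← xs ] ∑[ y ← ys ] f (g x y)
∑←-concatMap-map g []       ys f = refl
∑←-concatMap-map g (x ∷ xs) ys f = begin
  ∑[ z ← List.map (g x) ys ++ concatMap (λ x → List.map (g x) ys) xs ] f z
    ≡⟨ ∑←-++ (List.map (g x) ys) _ f ⟩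
  ∑[ z ← List.map (g x) ys ] f z + ∑[ z ← concatMap (λ x → List.map (g x) ys) xs ] f z
    ≡⟨ cong₂ _+_ (∑←-map (g x) ys f) (∑←-concatMap-map g xs ys f) ⟩
  ∑[ y ← ys ] f (g x y) + ∑[ x ← xs ] ∑[ y ← ys ] f (g x y) ∎

length-filter : ∀ {P : A → Set} (P? : ∀ x → Dec (P x)) (xs : List A) →
                length (filter P? xs) ≡ ∑[ x ← xs ] bit (does (P? x))
length-filter P? []       = refl
length-filter P? (x ∷ xs) with does (P? x)
... | true  = cong suc (length-filter P? xs)
... | false = length-filter P? xs

∑←-allVecs-suc : ∀ (xs : List A) n (f : Vec A (suc n) → ℕ) →
  ∑[ v ← allVecs xs (suc n) ] f v ≡ ∑[ x ← xs ] ∑[ v ← allVecs xs n ] f (x ∷ v)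
∑←-allVecs-suc xs n f = ∑←-concatMap-map _∷_ xs (allVecs xs n) f

-- Binomial sums and differences of power sums

-- binomialSum h n = ∑_{i < n} (n choose i) * h i: the top term i = n is left out.
-- The recursion is Pascal's rule.
binomialSum : (ℕ → ℕ) → ℕ → ℕ
binomialSum h zero    = 0
binomialSum h (suc n) = binomialSum h n + h n + binomialSum (h ∘ suc) n

binomialSum-cong : ∀ {u v : ℕ → ℕ} → (∀ i → u i ≡ v i) → ∀ n → binomialSum u n ≡ binomialSum v n
binomialSum-cong u≗v zero    = refl
binomialSum-cong u≗v (suc n) =
  cong₂ _+_ (cong₂ _+_ (binomialSum-cong u≗v n) (u≗v n)) (binomialSum-cong (u≗v ∘ suc) n)

binomialSum-*ˡ : ∀ c (u : ℕ → ℕ) n → binomialSum (λ i → c * u i) n ≡ c * binomialSum u n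
binomialSum-*ˡ c u zero    = sym (*-zeroʳ c)
binomialSum-*ˡ c u (suc n) = begin
  binomialSum (λ i → c * u i) n + c * u n + binomialSum (λ i → c * u (suc i)) n
    ≡⟨ cong₂ (λ a b → a + c * u n + b) (binomialSum-*ˡ c u n) (binomialSum-*ˡ c (u ∘ suc) n) ⟩
  c * binomialSum u n + c * u n + c * binomialSum (u ∘ suc) n
    ≡⟨ distrib c (binomialSum u n) (u n) _ ⟩
  c * (binomialSum u n + u n + binomialSum (u ∘ suc) n) ∎
  where
  distrib : ∀ c a b d → c * a + c * b + c * d ≡ c * (a + b + d)
  distrib = solve-∀

binomialSum-+ : ∀ (u v : ℕ → ℕ) n → binomialSum (λ i → u i + v i) n ≡ binomialSum u n + binomialSum v n
binomialSum-+ u v zero    = refl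
binomialSum-+ u v (suc n) = begin
  binomialSum (λ i → u i + v i) n + (u n + v n) + binomialSum (λ i → u (suc i) + v (suc i)) n
    ≡⟨ cong₂ (λ a b → a + (u n + v n) + b) (binomialSum-+ u v n) (binomialSum-+ (u ∘ suc) (v ∘ suc) n) ⟩
  (binomialSum u n + binomialSum v n) + (u n + v n) + (binomialSum (u ∘ suc) n + binomialSum (v ∘ suc) n)
    ≡⟨ regroup (binomialSum u n) (binomialSum v n) (u n) (v n) _ _ ⟩
  binomialSum u (suc n) + binomialSum v (suc n) ∎
  where
  regroup : ∀ a b c d e f → a + b + (c + d) + (e + f) ≡ a + c + e + (b + d + f)
  regroup = solve-∀

binomialSum-∑← : ∀ (xs : List A) (f : A → ℕ → ℕ) n →
  binomialSum (λ i → ∑[ x ← xs ] f x i) n ≡ ∑[ x ← xs ] binomialSum (f x) n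
binomialSum-∑← xs f zero    = sym (∑←-zero xs)
binomialSum-∑← xs f (suc n) = begin
  binomialSum F n + F n + binomialSum (F ∘ suc) n
    ≡⟨ cong₂ (λ a b → a + F n + b) (binomialSum-∑← xs f n) (binomialSum-∑← xs (λ x → f x ∘ suc) n) ⟩
  ∑[ x ← xs ] binomialSum (f x) n + F n + ∑[ x ← xs ] binomialSum (f x ∘ suc) n
    ≡⟨ cong (_+ ∑[ x ← xs ] binomialSum (f x ∘ suc) n) (sym (∑←-distrib-+ xs _ (λ x → f x n))) ⟩
  ∑[ x ← xs ] (binomialSum (f x) n + f x n) + ∑[ x ← xs ] binomialSum (f x ∘ suc) n
    ≡⟨ sym (∑←-distrib-+ xs _ _) ⟩
  ∑[ x ← xs ] binomialSum (f x) (suc n) ∎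
  where
  F : ℕ → ℕ
  F i = ∑[ x ← xs ] f x i

binomialSum-∑←-*ˡ : ∀ (xs : List A) (c : A → ℕ) (f : A → ℕ → ℕ) n →
  binomialSum (λ i → ∑[ x ← xs ] (c x * f x i)) n ≡ ∑[ x ← xs ] (c x * binomialSum (f x) n)
binomialSum-∑←-*ˡ xs c f n =
  trans (binomialSum-∑← xs (λ x i → c x * f x i) n) (∑←-cong xs (λ x → binomialSum-*ˡ (c x) (f x) n))

binomialSum-pow : ∀ b n → binomialSum (b ^_) n + b ^ n ≡ suc b ^ n
binomialSum-pow b zero    = refl
binomialSum-pow b (suc n) = begin
  binomialSum (b ^_) n + b ^ n + binomialSum (λ i → b * b ^ i) n + b * b ^ n
    ≡⟨ cong (λ z → binomialSum (b ^_) n + b ^ n + z + b * b ^ n) (binomialSum-*ˡ b (b ^_) n) ⟩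
  binomialSum (b ^_) n + b ^ n + b * binomialSum (b ^_) n + b * b ^ n
    ≡⟨ regroup (binomialSum (b ^_) n + b ^ n) (binomialSum (b ^_) n) (b ^ n) b ⟩
  (binomialSum (b ^_) n + b ^ n) + b * (binomialSum (b ^_) n + b ^ n)
    ≡⟨ cong (λ z → z + b * z) (binomialSum-pow b n) ⟩
  suc b ^ n + b * suc b ^ n ∎
  where
  regroup : ∀ s a c b → s + b * a + b * c ≡ s + b * (a + c)
  regroup = solve-∀

powerSum : List ℕ → ℕ → ℕ
powerSum bs n = ∑[ b ← bs ] (b ^ n)

binomialSum-powerSum : ∀ bs n → binomialSum (powerSum bs) n + powerSum bs n ≡ powerSum (List.map suc bs) n
binomialSum-powerSum bs n = begin
  binomialSum (powerSum bs) n + powerSum bs n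
    ≡⟨ cong (_+ powerSum bs n) (binomialSum-∑← bs _^_ n) ⟩
  ∑[ b ← bs ] binomialSum (b ^_) n + powerSum bs n
    ≡⟨ sym (∑←-distrib-+ bs _ _) ⟩
  ∑[ b ← bs ] (binomialSum (b ^_) n + b ^ n)
    ≡⟨ ∑←-cong bs (λ b → binomialSum-pow b n) ⟩
  ∑[ b ← bs ] (suc b ^ n)
    ≡⟨ sym (∑←-map suc bs (_^ n)) ⟩
  powerSum (List.map suc bs) n ∎

-- u n = powerSum q n − powerSum p n, with the subtraction moved to the left.
PowerSumDiff : (ℕ → ℕ) → Set
PowerSumDiff u = ∃₂ λ p q → ∀ n → u n + powerSum p n ≡ powerSum q n

powerSumDiff-resp : ∀ {u v : ℕ → ℕ} → (∀ n → u n ≡ v n) → PowerSumDiff u → PowerSumDiff v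
powerSumDiff-resp u≗v (p , q , eq) = p , q , λ n → trans (cong (_+ powerSum p n) (sym (u≗v n))) (eq n)

powerSumDiff-powerSum : ∀ bs → PowerSumDiff (powerSum bs)
powerSumDiff-powerSum bs = [] , bs , λ n → +-identityʳ (powerSum bs n)

powerSumDiff-+ : ∀ {u v : ℕ → ℕ} → PowerSumDiff u → PowerSumDiff v → PowerSumDiff (λ n → u n + v n)
powerSumDiff-+ {u} {v} (p , q , eq) (p′ , q′ , eq′) = p ++ p′ , q ++ q′ , λ n → begin
  u n + v n + powerSum (p ++ p′) n      ≡⟨ cong (u n + v n +_) (∑←-++ p p′ (_^ n)) ⟩
  u n + v n + (powerSum p n + powerSum p′ n) ≡⟨ +-+-comm (u n) (v n) _ _ ⟩
  (u n + powerSum p n) + (v n + powerSum p′ n) ≡⟨ cong₂ _+_ (eq n) (eq′ n) ⟩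
  powerSum q n + powerSum q′ n              ≡⟨ sym (∑←-++ q q′ (_^ n)) ⟩
  powerSum (q ++ q′) n ∎
  where
  +-+-comm : ∀ a b c d → a + b + (c + d) ≡ a + c + (b + d)
  +-+-comm = solve-∀

powerSumDiff-cancel : ∀ {u a b : ℕ → ℕ} → PowerSumDiff a → PowerSumDiff b →
                      (∀ n → u n + a n ≡ b n) → PowerSumDiff u
powerSumDiff-cancel {u} {a} {b} (pa , qa , eqa) (pb , qb , eqb) eq = qa ++ pb , qb ++ pa , λ n → begin
  u n + powerSum (qa ++ pb) n                  ≡⟨ cong (u n +_) (∑←-++ qa pb (_^ n)) ⟩
  u n + (powerSum qa n + powerSum pb n)        ≡⟨ cong (λ z → u n + (z + powerSum pb n)) (sym (eqa n)) ⟩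
  u n + (a n + powerSum pa n + powerSum pb n)  ≡⟨ regroup (u n) (a n) (powerSum pa n) (powerSum pb n) ⟩
  (u n + a n) + powerSum pb n + powerSum pa n  ≡⟨ cong (λ z → z + powerSum pb n + powerSum pa n) (eq n) ⟩
  b n + powerSum pb n + powerSum pa n          ≡⟨ cong (_+ powerSum pa n) (eqb n) ⟩
  powerSum qb n + powerSum pa n                ≡⟨ sym (∑←-++ qb pa (_^ n)) ⟩
  powerSum (qb ++ pa) n ∎
  where
  regroup : ∀ u a c d → u + (a + c + d) ≡ u + a + d + c
  regroup = solve-∀

powerSumDiff-binomialSum : ∀ {u : ℕ → ℕ} → PowerSumDiff u → PowerSumDiff (binomialSum u)
powerSumDiff-binomialSum {u} (p , q , eq) =
  powerSumDiff-cancel (binomialSumOfPowerSum p) (binomialSumOfPowerSum q) λ n → begin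
    binomialSum u n + binomialSum (powerSum p) n ≡⟨ sym (binomialSum-+ u (powerSum p) n) ⟩
    binomialSum (λ i → u i + powerSum p i) n    ≡⟨ binomialSum-cong eq n ⟩
    binomialSum (powerSum q) n ∎
  where
  binomialSumOfPowerSum : ∀ bs → PowerSumDiff (binomialSum (powerSum bs))
  binomialSumOfPowerSum bs = bs , List.map suc bs , binomialSum-powerSum bs

powerSumDiff-bit* : ∀ b {u : ℕ → ℕ} → PowerSumDiff u → PowerSumDiff (λ n → bit b * u n)
powerSumDiff-bit* false _  = powerSumDiff-powerSum []
powerSumDiff-bit* true  pu = powerSumDiff-resp (λ n → sym (+-identityʳ _)) pu

-- Counting tuples of pairwise related elements

bit-∧ : ∀ a b → bit (a ∧ b) ≡ bit a * bit b
bit-∧ false b = refl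
bit-∧ true  b = sym (+-identityʳ (bit b))

bit-idem : ∀ a → bit a * bit a ≡ bit a
bit-idem false = refl
bit-idem true  = refl

∧≡true⇒ : ∀ {a b} → a ∧ b ≡ true → a ≡ true × b ≡ true
∧≡true⇒ {true} {true} _ = refl , refl

does≡true⇒ : ∀ {P : Set} (P? : Dec P) → does P? ≡ true → P
does≡true⇒ (yes p) _ = p

module CompatibleTuples {A : Set} {R : A → A → Set} (R? : ∀ x y → Dec (R x y))
                        (R-refl : ∀ x → R x x) (R-sym : ∀ {x y} → R x y → R y x) where

  related : A → A → Bool
  related x y = does (R? x y)

  related-refl : ∀ x → related x x ≡ true
  related-refl x = dec-true (R? x x) (R-refl x)

  related-sym : ∀ x y → related x y ≡ related y x
  related-sym x y with R? x y | R? y x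
  ... | yes _   | yes _   = refl
  ... | no  _   | no  _   = refl
  ... | yes xRy | no ¬yRx = contradiction (R-sym xRy) ¬yRx
  ... | no ¬xRy | yes yRx = contradiction (R-sym yRx) ¬xRy

  compatible : A → List A → Bool
  compatible x = all (related x)

  compatibleTuple : ∀ {n} → List A → Vec A n → Bool
  compatibleTuple P []      = true
  compatibleTuple P (x ∷ v) = compatible x P ∧ compatibleTuple (x ∷ P) v

  compatibleTuple-sound : ∀ {n} P (v : Vec A n) → compatibleTuple P v ≡ true →
    (∀ i → compatible (lookup v i) P ≡ true) × (∀ i j → R (lookup v i) (lookup v j))
  compatibleTuple-sound P []      _ = (λ ()) , (λ ())
  compatibleTuple-sound P (x ∷ v) ok with ∧≡true⇒ {compatible x P} ok
  ... | x-ok , v-ok′ with compatibleTuple-sound (x ∷ P) v v-ok′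
  ... | v-ok , v-pairwise = ok-P , pairwise
    where
    ok-P : ∀ i → compatible (lookup (x ∷ v) i) P ≡ true
    ok-P zero    = x-ok
    ok-P (suc i) = proj₂ (∧≡true⇒ (v-ok i))
    pairwise : ∀ i j → R (lookup (x ∷ v) i) (lookup (x ∷ v) j)
    pairwise zero    zero    = R-refl x
    pairwise zero    (suc j) = R-sym (does≡true⇒ (R? _ _) (proj₁ (∧≡true⇒ (v-ok j))))
    pairwise (suc i) zero    = does≡true⇒ (R? _ _) (proj₁ (∧≡true⇒ (v-ok i)))
    pairwise (suc i) (suc j) = v-pairwise i j

  compatibleTuple-complete : ∀ {n} P (v : Vec A n) →
    (∀ i → compatible (lookup v i) P ≡ true) → (∀ i j → R (lookup v i) (lookup v j)) →
    compatibleTuple P v ≡ true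
  compatibleTuple-complete P []      _    _        = refl
  compatibleTuple-complete P (x ∷ v) ok-P pairwise rewrite ok-P zero =
    compatibleTuple-complete (x ∷ P) v
      (λ i → cong₂ _∧_ (dec-true (R? (lookup v i) x) (pairwise (suc i) zero)) (ok-P (suc i)))
      (λ i j → pairwise (suc i) (suc j))

  count : List A → ℕ → List A → ℕ
  count X n P = ∑[ v ← allVecs X n ] bit (compatibleTuple P v)

  count-suc : ∀ X n P → count X (suc n) P ≡ ∑[ x ← X ] (bit (compatible x P) * count X n (x ∷ P))
  count-suc X n P = begin
    count X (suc n) P
      ≡⟨ ∑←-allVecs-suc X n _ ⟩
    ∑[ x ← X ] ∑[ v ← allVecs X n ] bit (compatible x P ∧ compatibleTuple (x ∷ P) v)
      ≡⟨ ∑←-cong X (λ x → ∑←-cong (allVecs X n) (λ v → bit-∧ (compatible x P) _)) ⟩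
    ∑[ x ← X ] ∑[ v ← allVecs X n ] (bit (compatible x P) * bit (compatibleTuple (x ∷ P) v))
      ≡⟨ ∑←-cong X (λ x → sym (*-distribˡ-∑← (bit (compatible x P)) (allVecs X n) _)) ⟩
    ∑[ x ← X ] (bit (compatible x P) * count X n (x ∷ P)) ∎

  count-resp : ∀ X n {P Q} → (∀ y → compatible y P ≡ compatible y Q) → count X n P ≡ count X n Q
  count-resp X zero    P~Q = refl
  count-resp X (suc n) {P} {Q} P~Q = begin
    count X (suc n) P
      ≡⟨ count-suc X n P ⟩
    ∑[ x ← X ] (bit (compatible x P) * count X n (x ∷ P))
      ≡⟨ ∑←-cong X (λ x → cong₂ (λ a b → bit a * b) (P~Q x)
                      (count-resp X n (λ y → cong (related y x ∧_) (P~Q y)))) ⟩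
    ∑[ x ← X ] (bit (compatible x Q) * count X n (x ∷ Q))
      ≡⟨ sym (count-suc X n Q) ⟩
    count X (suc n) Q ∎

  count-dup : ∀ X n x P → count X n (x ∷ x ∷ P) ≡ count X n (x ∷ P)
  count-dup X n x P = count-resp X n (λ y → trans (sym (∧-assoc (related y x) _ _))
                                                  (cong (_∧ compatible y P) (∧-idem (related y x))))

  count-swap : ∀ X n x y P → count X n (x ∷ y ∷ P) ≡ count X n (y ∷ x ∷ P)
  count-swap X n x y P = count-resp X n (λ z → ∧-∧-comm (related z x) (related z y) (compatible z P))
    where
    ∧-∧-comm : ∀ a b c → a ∧ (b ∧ c) ≡ b ∧ (a ∧ c)
    ∧-∧-comm a b c = trans (sym (∧-assoc a b c)) (trans (cong (_∧ c) (∧-comm a b)) (∧-assoc b a c))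

  -- A tuple over x ∷ X compatible with P either avoids x, or has x exactly outside some
  -- set of i < n positions; then x is compatible with P and the entries at those i
  -- positions form a tuple over X compatible with x ∷ P.
  count-cons : ∀ x X n P →
    count (x ∷ X) n P ≡ count X n P + bit (compatible x P) * binomialSum (λ i → count X i (x ∷ P)) n
  count-cons x X zero    P = sym (cong (1 +_) (*-zeroʳ (bit (compatible x P))))
  count-cons x X (suc n) P = begin
    count (x ∷ X) (suc n) P
      ≡⟨ count-suc (x ∷ X) n P ⟩
    o * count (x ∷ X) n (x ∷ P) + ∑[ y ← X ] (oₚ y * count (x ∷ X) n (y ∷ P))
      ≡⟨ cong₂ _+_ startingWithX startingInX ⟩
    (o * h n + o * binomialSum h n) + (count X (suc n) P + o * binomialSum (h ∘ suc) n)
      ≡⟨ regroup o (h n) (binomialSum h n) (count X (suc n) P) (binomialSum (h ∘ suc) n) ⟩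
    count X (suc n) P + o * binomialSum h (suc n) ∎
    where
    oₚ : A → ℕ
    oₚ y = bit (compatible y P)
    o : ℕ
    o = oₚ x
    h : ℕ → ℕ
    h i = count X i (x ∷ P)
    binomialCount : A → A → ℕ
    binomialCount y z = binomialSum (λ i → count X i (y ∷ z ∷ P)) n

    regroup : ∀ o a b c d → o * a + o * b + (c + o * d) ≡ c + o * (b + a + d)
    regroup = solve-∀

    startingWithX : o * count (x ∷ X) n (x ∷ P) ≡ o * h n + o * binomialSum h n
    startingWithX = begin
      o * count (x ∷ X) n (x ∷ P)
        ≡⟨ cong (o *_) (count-cons x X n (x ∷ P)) ⟩
      o * (h n + bit (related x x ∧ compatible x P) * binomialCount x x)
        ≡⟨ cong₂ (λ a b → o * (h n + bit (a ∧ compatible x P) * b)) (related-refl x)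
                 (binomialSum-cong (λ i → count-dup X i x P) n) ⟩
      o * (h n + o * binomialSum h n)
        ≡⟨ *-distribˡ-+ o (h n) _ ⟩
      o * h n + o * (o * binomialSum h n)
        ≡⟨ cong (o * h n +_) (trans (sym (*-assoc o o _))
                                    (cong (_* binomialSum h n) (bit-idem (compatible x P)))) ⟩
      o * h n + o * binomialSum h n ∎

    reorder : ∀ y → oₚ y * (bit (compatible x (y ∷ P)) * binomialCount x y)
                  ≡ o * (bit (compatible y (x ∷ P)) * binomialCount y x)
    reorder y = begin
      oₚ y * (bit (related x y ∧ compatible x P) * binomialCount x y)
        ≡⟨ cong₂ (λ a b → oₚ y * (a * b))
                 (trans (bit-∧ (related x y) (compatible x P)) (cong (λ r → bit r * o) (related-sym x y)))
                 (binomialSum-cong (λ i → count-swap X i x y P) n) ⟩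
      oₚ y * (bit (related y x) * o * binomialCount y x)
        ≡⟨ shuffle (oₚ y) (bit (related y x)) o _ ⟩
      o * (bit (related y x) * oₚ y * binomialCount y x)
        ≡⟨ cong (λ a → o * (a * binomialCount y x)) (sym (bit-∧ (related y x) (compatible y P))) ⟩
      o * (bit (compatible y (x ∷ P)) * binomialCount y x) ∎
      where
      shuffle : ∀ a b c d → a * (b * c * d) ≡ c * (b * a * d)
      shuffle = solve-∀

    startingInX : ∑[ y ← X ] (oₚ y * count (x ∷ X) n (y ∷ P)) ≡ count X (suc n) P + o * binomialSum (h ∘ suc) n
    startingInX = begin
      ∑[ y ← X ] (oₚ y * count (x ∷ X) n (y ∷ P))
        ≡⟨ ∑←-cong X (λ y → trans (cong (oₚ y *_) (count-cons x X n (y ∷ P))) (*-distribˡ-+ (oₚ y) _ _)) ⟩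
      ∑[ y ← X ] (oₚ y * count X n (y ∷ P) + oₚ y * (bit (compatible x (y ∷ P)) * binomialCount x y))
        ≡⟨ ∑←-distrib-+ X _ _ ⟩
      ∑[ y ← X ] (oₚ y * count X n (y ∷ P)) + ∑[ y ← X ] (oₚ y * (bit (compatible x (y ∷ P)) * binomialCount x y))
        ≡⟨ cong₂ _+_ (sym (count-suc X n P)) (∑←-cong X reorder) ⟩
      count X (suc n) P + ∑[ y ← X ] (o * (bit (compatible y (x ∷ P)) * binomialCount y x))
        ≡⟨ cong (count X (suc n) P +_) (sym (*-distribˡ-∑← o X _)) ⟩
      count X (suc n) P + o * ∑[ y ← X ] (bit (compatible y (x ∷ P)) * binomialCount y x)
        ≡⟨ cong (λ z → count X (suc n) P + o * z)
                (sym (binomialSum-∑←-*ˡ X (λ y → bit (compatible y (x ∷ P))) (λ y i → count X i (y ∷ x ∷ P)) n)) ⟩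
      count X (suc n) P + o * binomialSum (λ i → ∑[ y ← X ] (bit (compatible y (x ∷ P)) * count X i (y ∷ x ∷ P))) n
        ≡⟨ cong (λ z → count X (suc n) P + o * z) (binomialSum-cong (λ i → sym (count-suc X i (x ∷ P))) n) ⟩
      count X (suc n) P + o * binomialSum (h ∘ suc) n ∎

  count-powerSumDiff : ∀ X P → PowerSumDiff (λ n → count X n P)
  count-powerSumDiff []      P = [] , 0 ∷ [] , λ { zero → refl ; (suc n) → refl }
  count-powerSumDiff (x ∷ X) P =
    powerSumDiff-resp (λ n → sym (count-cons x X n P))
      (powerSumDiff-+ (count-powerSumDiff X P)
                      (powerSumDiff-bit* (compatible x P)
                        (powerSumDiff-binomialSum (count-powerSumDiff X (x ∷ P)))))

-- Lonesum matrices are chain matrices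

sum-mono-≤ : ∀ {n} {f g : Fin n → ℕ} → (∀ i → f i ≤ g i) → sum f ≤ sum g
sum-mono-≤ {zero}  f≤g = z≤n
sum-mono-≤ {suc n} f≤g = +-mono-≤ (f≤g zero) (sum-mono-≤ (f≤g ∘ suc))

sum-mono-< : ∀ {n} {f g : Fin n → ℕ} → (∀ i → f i ≤ g i) → ∀ i → f i < g i → sum f < sum g
sum-mono-< {suc n} f≤g zero    fi<gi = +-mono-<-≤ fi<gi (sum-mono-≤ (f≤g ∘ suc))
sum-mono-< {suc n} f≤g (suc i) fi<gi = +-mono-≤-< (f≤g zero) (sum-mono-< (f≤g ∘ suc) i fi<gi)

sum-≡⇒≗ : ∀ {n} {f g : Fin n → ℕ} → (∀ i → f i ≤ g i) → sum f ≡ sum g → ∀ i → f i ≡ g i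
sum-≡⇒≗ f≤g ∑f≡∑g i with m≤n⇒m<n∨m≡n (f≤g i)
... | inj₂ fi≡gi = fi≡gi
... | inj₁ fi<gi = contradiction ∑f≡∑g (<⇒≢ (sum-mono-< f≤g i fi<gi))

bit-mono : ∀ {a b} → a Bool.≤ b → bit a ≤ bit b
bit-mono Bool.f≤t = z≤n
bit-mono Bool.b≤b = ≤-refl

bit-injective : ∀ {a b} → bit a ≡ bit b → a ≡ b
bit-injective {false} {false} _ = refl
bit-injective {true}  {true}  _ = refl

bit≤1 : ∀ a → bit a ≤ 1
bit≤1 false = z≤n
bit≤1 true  = ≤-refl

bit*bit≤ʳ : ∀ a b → bit a * bit b ≤ bit b
bit*bit≤ʳ false b = z≤n
bit*bit≤ʳ true  b = ≤-reflexive (+-identityʳ (bit b))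

bit*bit≤ˡ : ∀ a b → bit a * bit b ≤ bit a
bit*bit≤ˡ a b = subst (_≤ bit a) (*-comm (bit b) (bit a)) (bit*bit≤ʳ b a)

≡-by-lookup : ∀ {X : Set} {n} (u v : Vec X n) → (∀ i → lookup u i ≡ lookup v i) → u ≡ v
≡-by-lookup u v u≗v = trans (sym (tabulate∘lookup u)) (trans (tabulate-cong u≗v) (tabulate∘lookup v))

lookup-transpose : ∀ {X : Set} {k n} (A : Vec (Vec X n) k) i j →
                   lookup (lookup (transpose A) j) i ≡ lookup (lookup A i) j
lookup-transpose {n = n} (row ∷ A) i j = begin
  lookup (lookup (replicate n Vec._∷_ ⊛ row ⊛ transpose A) j) i
    ≡⟨ cong (λ col → lookup col i) (lookup-⊛ j (replicate n Vec._∷_ ⊛ row) (transpose A)) ⟩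
  lookup (lookup (replicate n Vec._∷_ ⊛ row) j (lookup (transpose A) j)) i
    ≡⟨ cong (λ f → lookup (f (lookup (transpose A) j)) i)
            (trans (lookup-⊛ j (replicate n Vec._∷_) row)
                   (cong (λ f → f (lookup row j)) (lookup-replicate j Vec._∷_))) ⟩
  lookup (lookup row j ∷ lookup (transpose A) j) i
    ≡⟨ lookup-cons i ⟩
  lookup (lookup (row ∷ A) i) j ∎
  where
  lookup-cons : ∀ i → lookup (lookup row j ∷ lookup (transpose A) j) i ≡ lookup (lookup (row ∷ A) i) j
  lookup-cons zero    = refl
  lookup-cons (suc i) = lookup-transpose A i j

entry : ∀ {k n} → Matrix k n → Fin k → Fin n → Bool
entry A i j = lookup (lookup A i) j

matrix-ext : ∀ {k n} {A B : Matrix k n} → (∀ i j → entry A i j ≡ entry B i j) → A ≡ B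
matrix-ext {A = A} {B} A≗B = ≡-by-lookup A B (λ i → ≡-by-lookup (lookup A i) (lookup B i) (A≗B i))

rowSum : ∀ {k n} → Matrix k n → Fin k → ℕ
rowSum {n = n} A i = ∑[ j < n ] bit (entry A i j)

colSum : ∀ {k n} → Matrix k n → Fin n → ℕ
colSum {k} A j = ∑[ i < k ] bit (entry A i j)

bitSum≡sum : ∀ {n} (v : Vec Bool n) → bitSum v ≡ ∑[ j < n ] bit (lookup v j)
bitSum≡sum []      = refl
bitSum≡sum (b ∷ v) = cong (bit b +_) (bitSum≡sum v)

lookup-rowSums : ∀ {k n} (A : Matrix k n) i → lookup (rowSums A) i ≡ rowSum A i
lookup-rowSums A i = trans (lookup-map i bitSum A) (bitSum≡sum (lookup A i))

lookup-colSums : ∀ {k n} (A : Matrix k n) j → lookup (colSums A) j ≡ colSum A j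
lookup-colSums A j = begin
  lookup (Vec.map bitSum (transpose A)) j ≡⟨ lookup-map j bitSum (transpose A) ⟩
  bitSum (lookup (transpose A) j)          ≡⟨ bitSum≡sum (lookup (transpose A) j) ⟩
  sum (λ i → bit (lookup (lookup (transpose A) j) i)) ≡⟨ sum-cong-≗ (λ i → cong bit (lookup-transpose A i j)) ⟩
  colSum A j ∎

rowSums-≡⇔ : ∀ {k n} {A B : Matrix k n} → rowSums B ≡ rowSums A ⇔ (∀ i → rowSum B i ≡ rowSum A i)
rowSums-≡⇔ {A = A} {B} = mk⇔
  (λ eq i → trans (sym (lookup-rowSums B i)) (trans (cong (λ v → lookup v i) eq) (lookup-rowSums A i)))
  (λ eq → ≡-by-lookup _ _ (λ i → trans (lookup-rowSums B i) (trans (eq i) (sym (lookup-rowSums A i)))))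

colSums-≡⇔ : ∀ {k n} {A B : Matrix k n} → colSums B ≡ colSums A ⇔ (∀ j → colSum B j ≡ colSum A j)
colSums-≡⇔ {A = A} {B} = mk⇔
  (λ eq j → trans (sym (lookup-colSums B j)) (trans (cong (λ v → lookup v j) eq) (lookup-colSums A j)))
  (λ eq → ≡-by-lookup _ _ (λ j → trans (lookup-colSums B j) (trans (eq j) (sym (lookup-colSums A j)))))

ColumnIncluded : ∀ {k n} → Matrix k n → Fin n → Fin n → Set
ColumnIncluded A j j′ = ∀ i → entry A i j Bool.≤ entry A i j′

Chain : ∀ {k n} → Matrix k n → Set
Chain A = ∀ j j′ → ColumnIncluded A j j′ ⊎ ColumnIncluded A j′ j

<⇒<ᵇ≡true : ∀ {m n} → m < n → (m <ᵇ n) ≡ true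
<⇒<ᵇ≡true m<n = Equivalence.to T-≡ (<⇒<ᵇ m<n)

<ᵇ≡true⇒< : ∀ {m n} → (m <ᵇ n) ≡ true → m < n
<ᵇ≡true⇒< {m} {n} m<ᵇn = <ᵇ⇒< m n (Equivalence.from T-≡ m<ᵇn)

true≤⇒≡true : ∀ {b} → true Bool.≤ b → b ≡ true
true≤⇒≡true Bool.b≤b = refl

module ChainLonesum {k n} {A B : Matrix k n} (chain : Chain A)
                    (rowSum≡ : ∀ i → rowSum B i ≡ rowSum A i)
                    (colSum≡ : ∀ j → colSum B j ≡ colSum A j) where

  -- In a chain matrix every row is an up-set for the preorder of columns by their sums.
  zero-one⇒colSum< : ∀ {i j j′} → entry A i j ≡ false → entry A i j′ ≡ true → colSum A j < colSum A j′
  zero-one⇒colSum< {i} {j} {j′} Aij≡0 Aij′≡1 with chain j j′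
  ... | inj₁ j⊆j′ = sum-mono-< (λ i → bit-mono (j⊆j′ i)) i
                      (subst₂ (λ a b → bit a < bit b) (sym Aij≡0) (sym Aij′≡1) ≤-refl)
  ... | inj₂ j′⊆j = contradiction (subst₂ Bool._≤_ Aij′≡1 Aij≡0 (j′⊆j i)) (λ ())

  one⇒one-above : ∀ {i j j′} → entry A i j ≡ true → colSum A j < colSum A j′ → entry A i j′ ≡ true
  one⇒one-above {i} {j} {j′} Aij≡1 c<c′ with chain j j′
  ... | inj₁ j⊆j′ = true≤⇒≡true (subst (Bool._≤ entry A i j′) Aij≡1 (j⊆j′ i))
  ... | inj₂ j′⊆j = contradiction (sum-mono-≤ (λ i → bit-mono (j′⊆j i))) (<⇒≱ c<c′)

  -- Fix a column j and count, in each row, the ones lying in columns of larger sum than j.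
  -- B has at most as many as A in every row and the same number in total, so equality holds
  -- row by row; in a row where A has a 0 at j this forces B to have a 0 at j too.
  module _ (j : Fin n) where

    above : Fin n → Bool
    above j′ = colSum A j <ᵇ colSum A j′

    onesAbove : Matrix k n → Fin k → ℕ
    onesAbove X i = ∑[ j′ < n ] (bit (above j′) * bit (entry X i j′))

    ∑-onesAbove : ∀ X → ∑[ i < k ] onesAbove X i ≡ ∑[ j′ < n ] (bit (above j′) * colSum X j′)
    ∑-onesAbove X = trans (∑-comm (λ i j′ → bit (above j′) * bit (entry X i j′)))
                          (sum-cong-≗ (λ j′ → sym (*-distribˡ-sum (bit (above j′)) (λ i → bit (entry X i j′)))))

    onesAbove-A-zero : ∀ i → entry A i j ≡ false → onesAbove A i ≡ rowSum A i
    onesAbove-A-zero i Aij≡0 = sum-cong-≗ onlyAbove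
      where
      onlyAbove : ∀ j′ → bit (above j′) * bit (entry A i j′) ≡ bit (entry A i j′)
      onlyAbove j′ with entry A i j′ in Aij′
      ... | false = *-zeroʳ (bit (above j′))
      ... | true  rewrite <⇒<ᵇ≡true (zero-one⇒colSum< Aij≡0 Aij′) = refl

    onesAbove-A-one : ∀ i → entry A i j ≡ true → onesAbove A i ≡ ∑[ j′ < n ] bit (above j′)
    onesAbove-A-one i Aij≡1 = sum-cong-≗ allAbove
      where
      allAbove : ∀ j′ → bit (above j′) * bit (entry A i j′) ≡ bit (above j′)
      allAbove j′ with above j′ in above-j′
      ... | false = refl
      ... | true  rewrite one⇒one-above Aij≡1 (<ᵇ≡true⇒< above-j′) = refl

    onesAbove-B≤A : ∀ i → onesAbove B i ≤ onesAbove A i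
    onesAbove-B≤A i with entry A i j in Aij
    ... | false = ≤-trans (sum-mono-≤ (λ j′ → bit*bit≤ʳ (above j′) (entry B i j′)))
                          (≤-reflexive (trans (rowSum≡ i) (sym (onesAbove-A-zero i Aij))))
    ... | true  = ≤-trans (sum-mono-≤ (λ j′ → bit*bit≤ˡ (above j′) (entry B i j′)))
                          (≤-reflexive (sym (onesAbove-A-one i Aij)))

    onesAbove-B≡A : ∀ i → onesAbove B i ≡ onesAbove A i
    onesAbove-B≡A = sum-≡⇒≗ onesAbove-B≤A (begin
      ∑[ i < k ] onesAbove B i                     ≡⟨ ∑-onesAbove B ⟩
      ∑[ j′ < n ] (bit (above j′) * colSum B j′)  ≡⟨ sum-cong-≗ (λ j′ → cong (bit (above j′) *_) (colSum≡ j′)) ⟩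
      ∑[ j′ < n ] (bit (above j′) * colSum A j′)  ≡⟨ ∑-onesAbove A ⟨
      ∑[ i < k ] onesAbove A i ∎)

    zero-preserved : ∀ i → entry A i j ≡ false → entry B i j ≡ false
    zero-preserved i Aij≡0 = bit-injective (begin
      bit (entry B i j)
        ≡⟨ sum-≡⇒≗ (λ j′ → bit*bit≤ʳ (above j′) (entry B i j′)) onesAbove≡rowSum j ⟨
      bit (above j) * bit (entry B i j)
        ≡⟨ cong (λ a → bit a * bit (entry B i j)) (<ᵇ-irrefl (colSum A j)) ⟩
      0 ∎)
      where
      onesAbove≡rowSum : onesAbove B i ≡ rowSum B i
      onesAbove≡rowSum = trans (onesAbove-B≡A i) (trans (onesAbove-A-zero i Aij≡0) (sym (rowSum≡ i)))
      <ᵇ-irrefl : ∀ m → (m <ᵇ m) ≡ false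
      <ᵇ-irrefl zero    = refl
      <ᵇ-irrefl (suc m) = <ᵇ-irrefl m

  B≡A : B ≡ A
  B≡A = matrix-ext (λ i → bit-injective ∘ sum-≡⇒≗ (B≤A i) (rowSum≡ i))
    where
    B≤A : ∀ i j → bit (entry B i j) ≤ bit (entry A i j)
    B≤A i j with entry A i j in Aij
    ... | true  = bit≤1 (entry B i j)
    ... | false = ≤-reflexive (cong bit (zero-preserved j i Aij))

chain⇒lonesum : ∀ {k n} {A : Matrix k n} → Chain A → Lonesum A
chain⇒lonesum {A = A} chain B rowSums≡ colSums≡ =
  ChainLonesum.B≡A chain (Equivalence.to (rowSums-≡⇔ {A = A} {B}) rowSums≡)
                         (Equivalence.to (colSums-≡⇔ {A = A} {B}) colSums≡)

transpose-matchˡ : ∀ {n} (i j : Fin n) → PC.transpose i j i ≡ j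
transpose-matchˡ i j with i ≟ i
... | yes _   = refl
... | no i≢i = contradiction refl i≢i

transpose-matchʳ : ∀ {n} (i j : Fin n) → PC.transpose i j j ≡ i
transpose-matchʳ i j with j ≟ i
... | yes j≡i = j≡i
... | no _ with j ≟ j
...   | yes _   = refl
...   | no j≢j = contradiction refl j≢j

transpose-other : ∀ {n} {i j k : Fin n} → k ≢ i → k ≢ j → PC.transpose i j k ≡ k
transpose-other {i = i} {j} {k} k≢i k≢j with k ≟ i
... | yes k≡i = contradiction k≡i k≢i
... | no _ with k ≟ j
...   | yes k≡j = contradiction k≡j k≢j
...   | no _    = refl

sum-transpose : ∀ {n} (f : Fin n → ℕ) (j₁ j₂ : Fin n) → sum (f ∘ PC.transpose j₁ j₂) ≡ sum f
sum-transpose f j₁ j₂ = sym (sum-permute f (Perm.transpose j₁ j₂))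

¬≤⇒true-false : ∀ {a b} → ¬ a Bool.≤ b → a ≡ true × b ≡ false
¬≤⇒true-false {false} {b}     a≰b = contradiction (≤-minimum b) a≰b
¬≤⇒true-false {true}  {true}  a≰b = contradiction Bool.b≤b a≰b
¬≤⇒true-false {true}  {false} a≰b = refl , refl

¬included⇒witness : ∀ {k n} {A : Matrix k n} {j j′} → ¬ ColumnIncluded A j j′ →
                    ∃ λ i → entry A i j ≡ true × entry A i j′ ≡ false
¬included⇒witness {A = A} {j} {j′} j⊈j′ with ¬∀⟶∃¬ _ _ (λ i → entry A i j Bool.≤? entry A i j′) j⊈j′
... | i , Aij≰Aij′ = i , ¬≤⇒true-false Aij≰Aij′

-- Exchanging the ones of a 2 × 2 submatrix [1 0; 0 1] with its zeros preserves all
-- row and column sums; done here by swapping the columns j₁ and j₂ in the rows i₁ and i₂.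
module SwapSubmatrix {k n} (A : Matrix k n) {i₁ i₂ : Fin k} {j₁ j₂ : Fin n}
                     (A₁₁ : entry A i₁ j₁ ≡ true) (A₁₂ : entry A i₁ j₂ ≡ false)
                     (A₂₁ : entry A i₂ j₁ ≡ false) (A₂₂ : entry A i₂ j₂ ≡ true) where

  τ : Fin n → Fin n
  τ = PC.transpose j₁ j₂

  σ : Fin k → Fin k
  σ = PC.transpose i₁ i₂

  swappedEntry : Fin k → Fin n → Bool
  swappedEntry i j with i ≟ i₁ | i ≟ i₂
  ... | no _ | no _ = entry A i j
  ... | _    | _    = entry A i (τ j)

  swapped : Matrix k n
  swapped = tabulate (λ i → tabulate (swappedEntry i))

  entry-swapped : ∀ i j → entry swapped i j ≡ swappedEntry i j
  entry-swapped i j = trans (cong (λ row → lookup row j) (lookup∘tabulate _ i)) (lookup∘tabulate _ j)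

  rowCases : ∀ i → i ≡ i₁ ⊎ i ≡ i₂ ⊎ (i ≢ i₁ × i ≢ i₂)
  rowCases i with i ≟ i₁ | i ≟ i₂
  ... | yes i≡i₁ | _        = inj₁ i≡i₁
  ... | no _     | yes i≡i₂ = inj₂ (inj₁ i≡i₂)
  ... | no i≢i₁  | no i≢i₂  = inj₂ (inj₂ (i≢i₁ , i≢i₂))

  swapped-row₁ : ∀ j → swappedEntry i₁ j ≡ entry A i₁ (τ j)
  swapped-row₁ j with i₁ ≟ i₁
  ... | yes _     = refl
  ... | no i₁≢i₁ = contradiction refl i₁≢i₁

  swapped-row₂ : ∀ j → swappedEntry i₂ j ≡ entry A i₂ (τ j)
  swapped-row₂ j with i₂ ≟ i₁ | i₂ ≟ i₂
  ... | yes _ | _         = refl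
  ... | no _  | yes _     = refl
  ... | no _  | no i₂≢i₂ = contradiction refl i₂≢i₂

  swapped-row-other : ∀ {i} → i ≢ i₁ → i ≢ i₂ → ∀ j → swappedEntry i j ≡ entry A i j
  swapped-row-other {i} i≢i₁ i≢i₂ j with i ≟ i₁ | i ≟ i₂
  ... | yes i≡i₁ | _        = contradiction i≡i₁ i≢i₁
  ... | no _     | yes i≡i₂ = contradiction i≡i₂ i≢i₂
  ... | no _     | no _     = refl

  swapped-row : ∀ i → (∀ j → swappedEntry i j ≡ entry A i j) ⊎ (∀ j → swappedEntry i j ≡ entry A i (τ j))
  swapped-row i with rowCases i
  ... | inj₁ refl                   = inj₂ swapped-row₁
  ... | inj₂ (inj₁ refl)            = inj₂ swapped-row₂
  ... | inj₂ (inj₂ (i≢i₁ , i≢i₂)) = inj₁ (swapped-row-other i≢i₁ i≢i₂)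

  pattern-symmetry : ∀ {i j} → i ≡ i₁ ⊎ i ≡ i₂ → j ≡ j₁ ⊎ j ≡ j₂ → entry A i (τ j) ≡ entry A (σ i) j
  pattern-symmetry (inj₁ refl) (inj₁ refl)
    rewrite transpose-matchˡ j₁ j₂ | transpose-matchˡ i₁ i₂ = trans A₁₂ (sym A₂₁)
  pattern-symmetry (inj₁ refl) (inj₂ refl)
    rewrite transpose-matchʳ j₁ j₂ | transpose-matchˡ i₁ i₂ = trans A₁₁ (sym A₂₂)
  pattern-symmetry (inj₂ refl) (inj₁ refl)
    rewrite transpose-matchˡ j₁ j₂ | transpose-matchʳ i₁ i₂ = trans A₂₂ (sym A₁₁)
  pattern-symmetry (inj₂ refl) (inj₂ refl)
    rewrite transpose-matchʳ j₁ j₂ | transpose-matchʳ i₁ i₂ = trans A₂₁ (sym A₁₂)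

  swapped-column₁₂ : ∀ {j} → j ≡ j₁ ⊎ j ≡ j₂ → ∀ i → swappedEntry i j ≡ entry A (σ i) j
  swapped-column₁₂ j∈ i with rowCases i
  ... | inj₁ refl                   = trans (swapped-row₁ _) (pattern-symmetry (inj₁ refl) j∈)
  ... | inj₂ (inj₁ refl)            = trans (swapped-row₂ _) (pattern-symmetry (inj₂ refl) j∈)
  ... | inj₂ (inj₂ (i≢i₁ , i≢i₂)) =
    trans (swapped-row-other i≢i₁ i≢i₂ _) (cong (λ i′ → entry A i′ _) (sym (transpose-other i≢i₁ i≢i₂)))

  swapped-column-other : ∀ {j} → j ≢ j₁ → j ≢ j₂ → ∀ i → swappedEntry i j ≡ entry A i j
  swapped-column-other j≢j₁ j≢j₂ i with swapped-row i
  ... | inj₁ same     = same _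
  ... | inj₂ permuted = trans (permuted _) (cong (entry A i) (transpose-other j≢j₁ j≢j₂))

  swapped-rowSum : ∀ i → rowSum swapped i ≡ rowSum A i
  swapped-rowSum i with swapped-row i
  ... | inj₁ same     = sum-cong-≗ (λ j → cong bit (trans (entry-swapped i j) (same j)))
  ... | inj₂ permuted = trans (sum-cong-≗ (λ j → cong bit (trans (entry-swapped i j) (permuted j))))
                              (sum-transpose (λ j → bit (entry A i j)) j₁ j₂)

  swapped-colSum₁₂ : ∀ {j} → j ≡ j₁ ⊎ j ≡ j₂ → colSum swapped j ≡ colSum A j
  swapped-colSum₁₂ {j} j∈ = trans (sum-cong-≗ (λ i → cong bit (trans (entry-swapped i j) (swapped-column₁₂ j∈ i))))
                                  (sum-transpose (λ i → bit (entry A i j)) i₁ i₂)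

  swapped-colSum : ∀ j → colSum swapped j ≡ colSum A j
  swapped-colSum j with j ≟ j₁ | j ≟ j₂
  ... | yes j≡j₁ | _       = swapped-colSum₁₂ (inj₁ j≡j₁)
  ... | no _    | yes j≡j₂ = swapped-colSum₁₂ (inj₂ j≡j₂)
  ... | no j≢j₁ | no j≢j₂  =
    sum-cong-≗ (λ i → cong bit (trans (entry-swapped i j) (swapped-column-other j≢j₁ j≢j₂ i)))

  swapped≢A : swapped ≢ A
  swapped≢A swapped≡A = contradiction (begin
    true                    ≡⟨ A₁₁ ⟨
    entry A i₁ j₁           ≡⟨ cong (λ X → entry X i₁ j₁) swapped≡A ⟨
    entry swapped i₁ j₁     ≡⟨ entry-swapped i₁ j₁ ⟩
    swappedEntry i₁ j₁      ≡⟨ swapped-row₁ j₁ ⟩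
    entry A i₁ (τ j₁)       ≡⟨ cong (entry A i₁) (transpose-matchˡ j₁ j₂) ⟩
    entry A i₁ j₂           ≡⟨ A₁₂ ⟩
    false ∎) (λ ())

  ¬lonesum : ¬ Lonesum A
  ¬lonesum lonesum = swapped≢A (lonesum swapped
    (Equivalence.from (rowSums-≡⇔ {A = A} {swapped}) swapped-rowSum)
    (Equivalence.from (colSums-≡⇔ {A = A} {swapped}) swapped-colSum))

lonesum⇒chain : ∀ {k n} {A : Matrix k n} → Lonesum A → Chain A
lonesum⇒chain {A = A} lonesum j j′ with all? (λ i → entry A i j Bool.≤? entry A i j′)
                                       | all? (λ i → entry A i j′ Bool.≤? entry A i j)
... | yes j⊆j′ | _        = inj₁ j⊆j′
... | no _     | yes j′⊆j = inj₂ j′⊆j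
... | no j⊈j′  | no j′⊈j with ¬included⇒witness {A = A} j⊈j′ | ¬included⇒witness {A = A} j′⊈j
...   | i₁ , A₁₁ , A₁₂ | i₂ , A₂₂ , A₂₁ = contradiction lonesum (SwapSubmatrix.¬lonesum A A₁₁ A₁₂ A₂₁ A₂₂)

-- L(k, n) as a count of tuples of comparable columns

_⊆_ : ∀ {k} → Vec Bool k → Vec Bool k → Set
c ⊆ d = ∀ i → lookup c i Bool.≤ lookup d i

Comparable : ∀ {k} → Vec Bool k → Vec Bool k → Set
Comparable c d = c ⊆ d ⊎ d ⊆ c

comparable? : ∀ {k} (c d : Vec Bool k) → Dec (Comparable c d)
comparable? c d = all? (λ i → lookup c i Bool.≤? lookup d i) ⊎-dec all? (λ i → lookup d i Bool.≤? lookup c i)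

chain-transpose⇔ : ∀ {k n} (C : Vec (Vec Bool k) n) →
                   Chain (transpose C) ⇔ (∀ j j′ → Comparable (lookup C j) (lookup C j′))
chain-transpose⇔ C = mk⇔ (λ chain j j′ → Sum.map toColumns toColumns (chain j j′))
                         (λ comparable j j′ → Sum.map fromColumns fromColumns (comparable j j′))
  where
  toColumns : ∀ {j j′} → ColumnIncluded (transpose C) j j′ → lookup C j ⊆ lookup C j′
  toColumns {j} {j′} j⊆j′ i = subst₂ Bool._≤_ (lookup-transpose C j i) (lookup-transpose C j′ i) (j⊆j′ i)
  fromColumns : ∀ {j j′} → lookup C j ⊆ lookup C j′ → ColumnIncluded (transpose C) j j′
  fromColumns {j} {j′} j⊆j′ i =
    subst₂ Bool._≤_ (sym (lookup-transpose C j i)) (sym (lookup-transpose C j′ i)) (j⊆j′ i)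

module ComparableColumns (k : ℕ) =
  CompatibleTuples (comparable? {k}) (λ c → inj₁ (λ i → Bool.b≤b)) Sum.swap

open ComparableColumns

lonesum?-transpose : ∀ {k n} (C : Vec (Vec Bool k) n) → does (lonesum? (transpose C)) ≡ compatibleTuple k [] C
lonesum?-transpose {k} C = ⇔→≡ (mk⇔
  (λ lonesum → compatibleTuple-complete k [] C (λ _ → refl)
                 (Equivalence.to (chain-transpose⇔ C) (lonesum⇒chain (does≡true⇒ (lonesum? _) lonesum))))
  (λ comparable → dec-true (lonesum? _)
                    (chain⇒lonesum (Equivalence.from (chain-transpose⇔ C)
                                     (proj₂ (compatibleTuple-sound k [] C comparable))))))

allVecs-[] : ∀ k → allVecs {A = Vec A 0} ([] ∷ []) k ≡ replicate k [] ∷ []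
allVecs-[] zero    = refl
allVecs-[] (suc k) = cong (λ vs → List.map (Vec.[] ∷_) vs ++ []) (allVecs-[] k)

∑←-allVecs-zipWith : ∀ (g : B → C → D) (ys : List B) (zs : List C) k (F : Vec D k → ℕ) →
  ∑[ v ← allVecs (concatMap (λ y → List.map (g y) zs) ys) k ] F v
    ≡ ∑[ u ← allVecs ys k ] ∑[ w ← allVecs zs k ] F (zipWith g u w)
∑←-allVecs-zipWith g ys zs zero    F = sym (+-identityʳ _)
∑←-allVecs-zipWith {D = D} g ys zs (suc k) F = begin
  ∑[ v ← allVecs W (suc k) ] F v
    ≡⟨ ∑←-allVecs-suc W k F ⟩
  ∑[ d ← W ] ∑[ v ← allVecs W k ] F (d ∷ v)
    ≡⟨ ∑←-concatMap-map g ys zs _ ⟩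
  ∑[ y ← ys ] ∑[ z ← zs ] ∑[ v ← allVecs W k ] F (g y z ∷ v)
    ≡⟨ ∑←-cong ys (λ y → ∑←-cong zs (λ z → ∑←-allVecs-zipWith g ys zs k (F ∘ (g y z ∷_)))) ⟩
  ∑[ y ← ys ] ∑[ z ← zs ] ∑[ u ← allVecs ys k ] ∑[ w ← allVecs zs k ] F (g y z ∷ zipWith g u w)
    ≡⟨ ∑←-cong ys (λ y → ∑←-comm zs (allVecs ys k) _) ⟩
  ∑[ y ← ys ] ∑[ u ← allVecs ys k ] ∑[ z ← zs ] ∑[ w ← allVecs zs k ] F (zipWith g (y ∷ u) (z ∷ w))
    ≡⟨ ∑←-cong ys (λ y → ∑←-cong (allVecs ys k) (λ u → ∑←-allVecs-suc zs k _)) ⟨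
  ∑[ y ← ys ] ∑[ u ← allVecs ys k ] ∑[ w ← allVecs zs (suc k) ] F (zipWith g (y ∷ u) w)
    ≡⟨ ∑←-allVecs-suc ys k _ ⟨
  ∑[ u ← allVecs ys (suc k) ] ∑[ w ← allVecs zs (suc k) ] F (zipWith g u w) ∎
  where
  W : List D
  W = concatMap (λ y → List.map (g y) zs) ys

∑←-allVecs-transpose : ∀ (xs : List A) k n (F : Vec (Vec A n) k → ℕ) →
  ∑[ M ← allVecs (allVecs xs n) k ] F M ≡ ∑[ C ← allVecs (allVecs xs k) n ] F (transpose C)
∑←-allVecs-transpose xs k zero    F = cong (λ Ms → ∑[ M ← Ms ] F M) (allVecs-[] k)
∑←-allVecs-transpose xs k (suc n) F = begin
  ∑[ M ← allVecs (allVecs xs (suc n)) k ] F M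
    ≡⟨ ∑←-allVecs-zipWith _∷_ xs (allVecs xs n) k F ⟩
  ∑[ c ← allVecs xs k ] ∑[ M ← allVecs (allVecs xs n) k ] F (zipWith _∷_ c M)
    ≡⟨ ∑←-cong (allVecs xs k) (λ c → ∑←-allVecs-transpose xs k n (F ∘ zipWith _∷_ c)) ⟩
  ∑[ c ← allVecs xs k ] ∑[ C ← allVecs (allVecs xs k) n ] F (zipWith _∷_ c (transpose C))
    ≡⟨ ∑←-cong (allVecs xs k) (λ c → ∑←-cong (allVecs (allVecs xs k) n)
                                               (λ C → cong F (zipWith-is-⊛ _∷_ c (transpose C)))) ⟩
  ∑[ c ← allVecs xs k ] ∑[ C ← allVecs (allVecs xs k) n ] F (transpose (c ∷ C))
    ≡⟨ ∑←-allVecs-suc (allVecs xs k) n (F ∘ transpose) ⟨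
  ∑[ C ← allVecs (allVecs xs k) (suc n) ] F (transpose C) ∎

L≡count : ∀ k n → L k n ≡ count k (allVecs (false ∷ true ∷ []) k) n []
L≡count k n = begin
  L k n
    ≡⟨ length-filter lonesum? (allMatrices k n) ⟩
  ∑[ A ← allMatrices k n ] bit (does (lonesum? A))
    ≡⟨ ∑←-allVecs-transpose (false ∷ true ∷ []) k n _ ⟩
  ∑[ C ← allVecs (allVecs (false ∷ true ∷ []) k) n ] bit (does (lonesum? (transpose C)))
    ≡⟨ ∑←-cong (allVecs (allVecs (false ∷ true ∷ []) k) n) (cong bit ∘ lonesum?-transpose) ⟩
  count k (allVecs (false ∷ true ∷ []) k) n [] ∎

L-powerSumDiff : ∀ k → PowerSumDiff (L k)
L-powerSumDiff k = powerSumDiff-resp (λ n → sym (L≡count k n)) (count-powerSumDiff k _ [])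

infix 4 _≡_mod_

_≡_mod_ : ℕ → ℕ → ℕ → Set
a ≡ b mod M = ∃₂ λ x y → a + x * M ≡ b + y * M

≡⇒≡-mod : ∀ {M a b} → a ≡ b → a ≡ b mod M
≡⇒≡-mod a≡b = 0 , 0 , cong (_+ 0) a≡b

mod-refl : ∀ {M} a → a ≡ a mod M
mod-refl a = ≡⇒≡-mod refl

mod-sym : ∀ {M a b} → a ≡ b mod M → b ≡ a mod M
mod-sym (x , y , eq) = y , x , sym eq

mod-trans : ∀ {M a b c} → a ≡ b mod M → b ≡ c mod M → a ≡ c mod M
mod-trans {M} {a} {b} {c} (x , y , eq₁) (z , w , eq₂) = x + z , y + w , (begin
  a + (x + z) * M     ≡⟨ split a x z M ⟩
  (a + x * M) + z * M ≡⟨ cong (_+ z * M) eq₁ ⟩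
  (b + y * M) + z * M ≡⟨ swap b y z M ⟩
  (b + z * M) + y * M ≡⟨ cong (_+ y * M) eq₂ ⟩
  (c + w * M) + y * M ≡⟨ join c w y M ⟩
  c + (y + w) * M ∎)
  where
  split : ∀ a x z M → a + (x + z) * M ≡ (a + x * M) + z * M
  split = solve-∀
  swap : ∀ b y z M → (b + y * M) + z * M ≡ (b + z * M) + y * M
  swap = solve-∀
  join : ∀ c w y M → (c + w * M) + y * M ≡ c + (y + w) * M
  join = solve-∀

mod-+ : ∀ {M a b c d} → a ≡ b mod M → c ≡ d mod M → a + c ≡ b + d mod M
mod-+ {M} {a} {b} {c} {d} (x , y , eq₁) (z , w , eq₂) = x + z , y + w , (begin
  a + c + (x + z) * M       ≡⟨ regroup a c x z M ⟩
  (a + x * M) + (c + z * M) ≡⟨ cong₂ _+_ eq₁ eq₂ ⟩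
  (b + y * M) + (d + w * M) ≡⟨ regroup b d y w M ⟨
  b + d + (y + w) * M ∎)
  where
  regroup : ∀ a c x z M → a + c + (x + z) * M ≡ (a + x * M) + (c + z * M)
  regroup = solve-∀

mod-* : ∀ {M a b c d} → a ≡ b mod M → c ≡ d mod M → a * c ≡ b * d mod M
mod-* {M} {a} {b} {c} {d} (x , y , eq₁) (z , w , eq₂) =
  x * c + a * z + x * z * M , y * d + b * w + y * w * M , (begin
  a * c + (x * c + a * z + x * z * M) * M ≡⟨ expand a c x z M ⟩
  (a + x * M) * (c + z * M)               ≡⟨ cong₂ _*_ eq₁ eq₂ ⟩
  (b + y * M) * (d + w * M)               ≡⟨ expand b d y w M ⟨
  b * d + (y * d + b * w + y * w * M) * M ∎)
  where
  expand : ∀ a c x z M → a * c + (x * c + a * z + x * z * M) * M ≡ (a + x * M) * (c + z * M)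
  expand = solve-∀

mod-^ : ∀ {M a b} → a ≡ b mod M → ∀ e → a ^ e ≡ b ^ e mod M
mod-^ a≡b zero    = mod-refl 1
mod-^ a≡b (suc e) = mod-* a≡b (mod-^ a≡b e)

mod-cancelʳ-+ : ∀ {M a b c} → a + c ≡ b + c mod M → a ≡ b mod M
mod-cancelʳ-+ {M} {a} {b} {c} (x , y , eq) = x , y , +-cancelʳ-≡ c _ _ (begin
  a + x * M + c ≡⟨ +-comm-last a (x * M) c ⟩
  a + c + x * M ≡⟨ eq ⟩
  b + c + y * M ≡⟨ +-comm-last b (y * M) c ⟨
  b + y * M + c ∎)
  where
  +-comm-last : ∀ a b c → a + b + c ≡ a + c + b
  +-comm-last = solve-∀

mod-*ˡ-scale : ∀ {M a b} c → a ≡ b mod M → c * a ≡ c * b mod c * M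
mod-*ˡ-scale {M} {a} {b} c (x , y , eq) = x , y , (begin
  c * a + x * (c * M) ≡⟨ factor c a x M ⟩
  c * (a + x * M)     ≡⟨ cong (c *_) eq ⟩
  c * (b + y * M)     ≡⟨ factor c b y M ⟨
  c * b + y * (c * M) ∎)
  where
  factor : ∀ c a x M → c * a + x * (c * M) ≡ c * (a + x * M)
  factor = solve-∀

mod-divisor : ∀ {M M′ a b} → M′ ∣ M → a ≡ b mod M → a ≡ b mod M′
mod-divisor {M} {M′} {a} {b} (divides q M≡qM′) (x , y , eq) = x * q , y * q , (begin
  a + x * q * M′ ≡⟨ cong (a +_) (trans (*-assoc x q M′) (cong (x *_) (sym M≡qM′))) ⟩
  a + x * M      ≡⟨ eq ⟩
  b + y * M      ≡⟨ cong (b +_) (trans (cong (y *_) M≡qM′) (sym (*-assoc y q M′))) ⟩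
  b + y * q * M′ ∎)

∣⇒≡0-mod : ∀ {M a} → M ∣ a → a ≡ 0 mod M
∣⇒≡0-mod {a = a} (divides q a≡qM) = 0 , q , trans (+-identityʳ a) a≡qM

%≡-mod : ∀ M .{{_ : NonZero M}} a → a % M ≡ a mod M
%≡-mod M a = a / M , 0 , trans (sym (m≡m%n+[m/n]*n a M)) (sym (+-identityʳ a))

mod-1 : ∀ a b → a ≡ b mod 1
mod-1 a b = b , a , (begin
  a + b * 1 ≡⟨ cong (a +_) (*-identityʳ b) ⟩
  a + b     ≡⟨ +-comm a b ⟩
  b + a     ≡⟨ cong (b +_) (*-identityʳ a) ⟨
  b + a * 1 ∎)

distance-multiple : ∀ {M a b x y} → a + x * M ≡ b + y * M → x ≤ y → ∣ a - b ∣ ≡ (y ∸ x) * M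
distance-multiple {M} {a} {b} {x} {y} eq x≤y = begin
  ∣ a - b ∣               ≡⟨ cong ∣_- b ∣ (+-cancelʳ-≡ (x * M) a (b + (y ∸ x) * M) (begin
    a + x * M                 ≡⟨ eq ⟩
    b + y * M                 ≡⟨ cong (λ z → b + z * M) (m∸n+n≡m x≤y) ⟨
    b + (y ∸ x + x) * M       ≡⟨ cong (b +_) (*-distribʳ-+ M (y ∸ x) x) ⟩
    b + ((y ∸ x) * M + x * M) ≡⟨ +-assoc b _ _ ⟨
    b + (y ∸ x) * M + x * M ∎)) ⟩
  ∣ b + (y ∸ x) * M - b ∣ ≡⟨ ∣-∣-comm (b + (y ∸ x) * M) b ⟩
  ∣ b - b + (y ∸ x) * M ∣ ≡⟨ ∣m-m+n∣≡n b _ ⟩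
  (y ∸ x) * M ∎

mod⇒∣ : ∀ {M a b} → a ≡ b mod M → M ∣ ∣ a - b ∣
mod⇒∣ {M} {a} {b} (x , y , eq) with ≤-total x y
... | inj₁ x≤y = divides (y ∸ x) (distance-multiple eq x≤y)
... | inj₂ y≤x = divides (x ∸ y) (trans (∣-∣-comm a b) (distance-multiple (sym eq) y≤x))

∣⇒mod : ∀ {M a b} → M ∣ ∣ a - b ∣ → a ≡ b mod M
∣⇒mod {M} {a} {b} (divides q ∣a-b∣≡qM) with ≤-total a b
... | inj₁ a≤b = q , 0 , (begin
  a + q * M       ≡⟨ cong (a +_) (trans (sym ∣a-b∣≡qM) (m≤n⇒∣m-n∣≡n∸m a≤b)) ⟩
  a + (b ∸ a)     ≡⟨ m+[n∸m]≡n a≤b ⟩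
  b               ≡⟨ +-identityʳ b ⟨
  b + 0 * M ∎)
... | inj₂ b≤a = 0 , q , (begin
  a + 0 * M       ≡⟨ +-identityʳ a ⟩
  a               ≡⟨ m+[n∸m]≡n b≤a ⟨
  b + (a ∸ b)     ≡⟨ cong (b +_) (trans (sym (m≤n⇒∣m-n∣≡n∸m b≤a)) (trans (∣-∣-comm b a) ∣a-b∣≡qM)) ⟩
  b + q * M ∎)

mod-<⇒≡ : ∀ {M a b} → a ≡ b mod M → a < M → b < M → a ≡ b
mod-<⇒≡ {M} {a} {b} a≡b a<M b<M =
  ∣m-n∣≡0⇒m≡n (∣-small (mod⇒∣ a≡b) (≤-<-trans (∣m-n∣≤m⊔n a b) (⊔-pres-<m a<M b<M)))
  where
  ∣-small : ∀ {d} → M ∣ d → d < M → d ≡ 0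
  ∣-small {zero}  _   _   = refl
  ∣-small {suc d} M∣d d<M = contradiction (∣⇒≤ M∣d) (<⇒≱ d<M)

mod-cancelʳ-coprime : ∀ {M a b c} → Coprime c M → a * c ≡ b * c mod M → a ≡ b mod M
mod-cancelʳ-coprime {M} {a} {b} {c} c⊥M ac≡bc = ∣⇒mod (coprime-divisor (Coprimality.sym c⊥M)
  (subst (M ∣_) (trans (sym (*-distribʳ-∣-∣ c a b)) (*-comm ∣ a - b ∣ c)) (mod⇒∣ ac≡bc)))

-- Squaring turns x ≡ -1 into x² ≡ 1, since x² + 2 (x + 1) = (x + 1)² + 1.
x+1≡0⇒x*x≡1 : ∀ {M} x → x + 1 ≡ 0 mod M → x * x ≡ 1 mod M
x+1≡0⇒x*x≡1 x x+1≡0 =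
  mod-trans (≡⇒≡-mod (sym (+-identityʳ (x * x))))
  (mod-trans (mod-sym (mod-+ (mod-refl (x * x)) 2[x+1]≡0))
  (mod-trans (≡⇒≡-mod (square x)) [x+1]²+1≡1))
  where
  square : ∀ x → x * x + 2 * (x + 1) ≡ (x + 1) * (x + 1) + 1
  square = solve-∀
  2[x+1]≡0 : 2 * (x + 1) ≡ 2 * 0 mod _
  2[x+1]≡0 = mod-* (mod-refl 2) x+1≡0
  [x+1]²+1≡1 : (x + 1) * (x + 1) + 1 ≡ 0 * 0 + 1 mod _
  [x+1]²+1≡1 = mod-+ (mod-* x+1≡0 x+1≡0) (mod-refl 1)

-- Bézout gives a x ≡ 1 or a x + 1 ≡ 0; in the second case a (x (a x)) = (a x)² ≡ 1.
coprime⇒inverse : ∀ {M a} → Coprime a M → ∃ λ a′ → a * a′ ≡ 1 mod M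
coprime⇒inverse {M} {a} a⊥M with coprime-Bézout a⊥M
... | Bézout.+- x y 1+yM≡xa = x , 0 , y , trans (+-identityʳ (a * x)) (trans (*-comm a x) (sym 1+yM≡xa))
... | Bézout.-+ x y 1+xa≡yM =
  x * (a * x) , mod-trans (≡⇒≡-mod (*-assoc-square a x)) (x+1≡0⇒x*x≡1 (a * x) ax+1≡0)
  where
  ax+1≡0 : a * x + 1 ≡ 0 mod M
  ax+1≡0 = 0 , y , trans (+-identityʳ _) (trans (+-comm (a * x) 1) (trans (cong suc (*-comm a x)) 1+xa≡yM))
  *-assoc-square : ∀ a x → a * (x * (a * x)) ≡ a * x * (a * x)
  *-assoc-square = solve-∀

chineseRemainder : ∀ {g M′} → Coprime g M′ → ∀ u v → ∃ λ w → w ≡ u mod g × w ≡ v mod M′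
chineseRemainder {g} {M′} g⊥M′ u v with coprime⇒inverse (Coprimality.sym g⊥M′) | coprime⇒inverse g⊥M′
... | e , M′e≡1 | f , gf≡1 = M′ * e * u + g * f * v , w≡u , w≡v
  where
  w≡u : M′ * e * u + g * f * v ≡ u mod g
  w≡u = mod-trans (mod-+ (mod-* M′e≡1 (mod-refl u)) (∣⇒≡0-mod (∣m⇒∣m*n v (∣m⇒∣m*n f ∣-refl))))
                  (≡⇒≡-mod (trans (+-identityʳ (1 * u)) (*-identityˡ u)))
  w≡v : M′ * e * u + g * f * v ≡ v mod M′
  w≡v = mod-trans (mod-+ (∣⇒≡0-mod (∣m⇒∣m*n u (∣m⇒∣m*n e ∣-refl))) (mod-* gf≡1 (mod-refl v)))
                  (≡⇒≡-mod (*-identityˡ v))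

coprime-resp-mod : ∀ {M a b} → a ≡ b mod M → Coprime b M → Coprime a M
coprime-resp-mod {M} {a} {b} (x , y , a+xM≡b+yM) b⊥M {d} (d∣a , d∣M) = b⊥M (d∣b , d∣M)
  where
  d∣b : d ∣ b
  d∣b = ∣m+n∣m⇒∣n (subst (d ∣_) (trans a+xM≡b+yM (+-comm b (y * M))) (∣m∣n⇒∣m+n d∣a (∣n⇒∣m*n x d∣M)))
                   (∣n⇒∣m*n y d∣M)

coprime-*ˡ : ∀ {m m′ n} → Coprime m n → Coprime m′ n → Coprime (m * m′) n
coprime-*ˡ {m} {m′} {n} m⊥n m′⊥n {d} (d∣mm′ , d∣n) = m′⊥n (coprime-divisor d⊥m d∣mm′ , d∣n)
  where
  d⊥m : Coprime d m
  d⊥m (e∣d , e∣m) = m⊥n (e∣m , ∣-trans e∣d d∣n)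

coprime-^ : ∀ {b M} k → Coprime b M → Coprime (b ^ k) M
coprime-^ zero    b⊥M = Coprimality.1-coprimeTo _
coprime-^ (suc k) b⊥M = coprime-*ˡ b⊥M (coprime-^ k b⊥M)

-- Euler's theorem

coprime-*ʳ⇒ : ∀ {m n k} → Coprime (m * n) k → Coprime n k
coprime-*ʳ⇒ {m} mn⊥k (d∣n , d∣k) = mn⊥k (∣n⇒∣m*n m d∣n , d∣k)

coprime-product : ∀ {M} xs → (∀ {x} → x ∈ xs → Coprime x M) → Coprime (product xs) M
coprime-product []       _     = Coprimality.1-coprimeTo _
coprime-product (x ∷ xs) xs⊥M = coprime-*ˡ (xs⊥M (here refl)) (coprime-product xs (xs⊥M ∘ there))

map⁺-injectiveOn : ∀ (f : A → B) {xs} → (∀ {x y} → x ∈ xs → y ∈ xs → f x ≡ f y → x ≡ y) →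
                   Unique xs → Unique (List.map f xs)
map⁺-injectiveOn f inj AllPairs.[]            = AllPairs.[]
map⁺-injectiveOn f inj (x≢xs AllPairs.∷ uniq) =
  All.map⁺ (All.tabulate (λ y∈xs fx≡fy → All.lookup x≢xs y∈xs (inj (here refl) (there y∈xs) fx≡fy)))
  AllPairs.∷ map⁺-injectiveOn f (λ x∈ y∈ → inj (there x∈) (there y∈)) uniq

-- φ M is by definition length (units M).
units : ℕ → List ℕ
units M = filter (λ i → gcd i M ℕ.≟ 1) (List.map suc (upTo M))

∈-units⁻ : ∀ {M x} → x ∈ units M → 0 < x × x ≤ M × Coprime x M
∈-units⁻ {M} x∈ with ∈-filter⁻ (λ i → gcd i M ℕ.≟ 1) {xs = List.map suc (upTo M)} x∈
... | x∈suc-upTo , gcd≡1 with ∈-map⁻ suc x∈suc-upTo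
...   | _ , y∈upTo , refl = z<s , ∈-upTo⁻ y∈upTo , Coprimality.gcd≡1⇒coprime gcd≡1

∈-units⁺ : ∀ {M x} → 0 < x → x ≤ M → Coprime x M → x ∈ units M
∈-units⁺ {M} {suc x} _ x<M x⊥M =
  ∈-filter⁺ (λ i → gcd i M ℕ.≟ 1) (∈-map⁺ suc (∈-upTo⁺ x<M)) (Coprimality.coprime⇒gcd≡1 x⊥M)

units-unique : ∀ M → Unique (units M)
units-unique M = Unique.filter⁺ (λ i → gcd i M ℕ.≟ 1) (Unique.map⁺ suc-injective (Unique.upTo⁺ M))

module MultiplicationByUnit (M : ℕ) .{{_ : NonZero M}} (1<M : 1 < M) where

  units-< : ∀ {x} → x ∈ units M → x < M
  units-< x∈ with ∈-units⁻ x∈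
  ... | _ , x≤M , x⊥M with m≤n⇒m<n∨m≡n x≤M
  ...   | inj₁ x<M  = x<M
  ...   | inj₂ refl = contradiction (x⊥M (∣-refl , ∣-refl)) (>⇒≢ 1<M)

  mulMod : ℕ → ℕ → ℕ
  mulMod c x = (c * x) % M

  mulMod-units : ∀ {c x} → Coprime c M → x ∈ units M → mulMod c x ∈ units M
  mulMod-units {c} {x} c⊥M x∈ = ∈-units⁺ positive (<⇒≤ (m%n<n (c * x) M)) cx%M⊥M
    where
    cx%M⊥M : Coprime (mulMod c x) M
    cx%M⊥M = coprime-resp-mod (%≡-mod M (c * x)) (coprime-*ˡ c⊥M (proj₂ (proj₂ (∈-units⁻ x∈))))
    positive : 0 < mulMod c x
    positive with mulMod c x | cx%M⊥M
    ... | zero  | 0⊥M = contradiction (Coprimality.0-coprimeTo-m⇒m≡1 0⊥M) (>⇒≢ 1<M)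
    ... | suc _ | _   = z<s

  mulMod-inverse : ∀ {c c′ x} → c * c′ ≡ 1 mod M → x < M → mulMod c (mulMod c′ x) ≡ x
  mulMod-inverse {c} {c′} {x} cc′≡1 x<M = mod-<⇒≡ cc′x≡x (m%n<n _ M) x<M
    where
    cc′x≡x : mulMod c (mulMod c′ x) ≡ x mod M
    cc′x≡x = mod-trans (%≡-mod M _)
             (mod-trans (mod-* (mod-refl c) (%≡-mod M (c′ * x)))
             (mod-trans (≡⇒≡-mod (sym (*-assoc c c′ x)))
             (mod-trans (mod-* cc′≡1 (mod-refl x)) (≡⇒≡-mod (*-identityˡ x)))))

  mulMod-↭ : ∀ {c} → Coprime c M → List.map (mulMod c) (units M) ↭ units M
  mulMod-↭ {c} c⊥M with coprime⇒inverse c⊥M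
  ... | c′ , cc′≡1 = ∼bag⇒↭ (unique∧set⇒bag (map⁺-injectiveOn (mulMod c) injective (units-unique M))
                                              (units-unique M) (mk⇔ into onto))
    where
    c′⊥M : Coprime c′ M
    c′⊥M = coprime-*ʳ⇒ {c} (coprime-resp-mod cc′≡1 (Coprimality.1-coprimeTo M))
    injective : ∀ {x y} → x ∈ units M → y ∈ units M → mulMod c x ≡ mulMod c y → x ≡ y
    injective {x} {y} x∈ y∈ cx≡cy = begin
      x                        ≡⟨ mulMod-inverse {c′} {c} c′c≡1 (units-< x∈) ⟨
      mulMod c′ (mulMod c x)   ≡⟨ cong (mulMod c′) cx≡cy ⟩
      mulMod c′ (mulMod c y)   ≡⟨ mulMod-inverse {c′} {c} c′c≡1 (units-< y∈) ⟩
      y ∎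
      where
      c′c≡1 : c′ * c ≡ 1 mod M
      c′c≡1 = mod-trans (≡⇒≡-mod (*-comm c′ c)) cc′≡1
    into : ∀ {z} → z ∈ List.map (mulMod c) (units M) → z ∈ units M
    into z∈ with ∈-map⁻ (mulMod c) z∈
    ... | x , x∈ , refl = mulMod-units c⊥M x∈
    onto : ∀ {z} → z ∈ units M → z ∈ List.map (mulMod c) (units M)
    onto z∈ = subst (_∈ _) (mulMod-inverse {c} {c′} cc′≡1 (units-< z∈))
                           (∈-map⁺ (mulMod c) (mulMod-units c′⊥M z∈))

  product-map-mulMod : ∀ c xs → product (List.map (mulMod c) xs) ≡ c ^ length xs * product xs mod M
  product-map-mulMod c []       = mod-refl 1
  product-map-mulMod c (x ∷ xs) =
    mod-trans (mod-* (%≡-mod M (c * x)) (product-map-mulMod c xs))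
              (≡⇒≡-mod (interchange c x (c ^ length xs) (product xs)))
    where
    interchange : ∀ c x d p → c * x * (d * p) ≡ c * d * (x * p)
    interchange = solve-∀

euler : ∀ {M a} → Coprime a M → a ^ φ M ≡ 1 mod M
euler {zero}              _   = mod-refl 1
euler {suc zero}          _   = mod-1 _ _
euler {M@(suc (suc _))} {a} a⊥M = mod-cancelʳ-coprime ∏units⊥M
  (mod-trans (mod-sym (product-map-mulMod a (units M)))
             (≡⇒≡-mod (trans (product-↭ (mulMod-↭ a⊥M)) (sym (*-identityˡ _)))))
  where
  open MultiplicationByUnit M (s<s z<s)
  ∏units⊥M : Coprime (product (units M)) M
  ∏units⊥M = coprime-product (units M) (λ x∈ → proj₂ (proj₂ (∈-units⁻ x∈)))

^-monoˡ-∣ : ∀ {p b} k → p ∣ b → p ^ k ∣ b ^ k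
^-monoˡ-∣ zero    _   = ∣-refl
^-monoˡ-∣ (suc k) p∣b = *-pres-∣ p∣b (^-monoˡ-∣ k p∣b)

^-monoʳ-∣ : ∀ p {t n} → t ≤ n → p ^ t ∣ p ^ n
^-monoʳ-∣ p {t} {n} t≤n = divides (p ^ (n ∸ t)) (begin
  p ^ n             ≡⟨ cong (p ^_) (m∸n+n≡m t≤n) ⟨
  p ^ (n ∸ t + t)   ≡⟨ ^-distribˡ-+-* p (n ∸ t) t ⟩
  p ^ (n ∸ t) * p ^ t ∎)

primeDivisor : ∀ {d} → 2 ≤ d → ∃ λ p → Prime p × p ∣ d
primeDivisor {suc zero} (s≤s ())
primeDivisor {d@(suc (suc _))} _ with factorise d
... | record { factors = p ∷ ps ; isFactorisation = d≡p*∏ps ; factorsPrime = p-prime All.∷ _ } =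
  p , p-prime , divides (product ps) (trans d≡p*∏ps (*-comm p (product ps)))

noCommonPrime⇒coprime : ∀ {a b} → b ≢ 0 → (∀ {p} → Prime p → p ∣ a → p ∣ b → ⊥) → Coprime a b
noCommonPrime⇒coprime b≢0 _        {zero}        (_ , 0∣b)   = contradiction (0∣⇒≡0 0∣b) b≢0
noCommonPrime⇒coprime _   _        {suc zero}    _           = refl
noCommonPrime⇒coprime _   noCommon {suc (suc _)} (d∣a , d∣b) with primeDivisor (s≤s (s≤s z≤n))
... | p , p-prime , p∣d = contradiction (∣-trans p∣d d∣b) (noCommon p-prime (∣-trans p∣d d∣a))

ExponentsBoundedBy : ℕ → ℕ → Set
ExponentsBoundedBy M n = ∀ p e → Prime p → p ^ e ∣ M → e ≤ n

-- With g = gcd (bⁿ, M) and M = M′ g: b is a unit modulo M′, as a prime dividing b and M′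
-- would divide M to a power above n.
-- Euler's theorem for a unit b′ ≡ b modulo M′ (Chinese remainder theorem) gives
-- b^φ(M) ≡ 1 modulo M′, and g ∣ bⁿ supplies the missing factor g of M.
module PowerPeriodicity {M : ℕ} (0<M : 0 < M) (b n : ℕ) (bounded : ExponentsBoundedBy M n) where

  g M′ h : ℕ
  g = gcd (b ^ n) M
  M′ = quotient (gcd[m,n]∣n (b ^ n) M)
  h = quotient (gcd[m,n]∣m (b ^ n) M)

  M≡M′g : M ≡ M′ * g
  M≡M′g = _∣_.equality (gcd[m,n]∣n (b ^ n) M)
  bⁿ≡hg : b ^ n ≡ h * g
  bⁿ≡hg = _∣_.equality (gcd[m,n]∣m (b ^ n) M)
  M≡gM′ : M ≡ g * M′
  M≡gM′ = trans M≡M′g (*-comm M′ g)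
  M′≢0 : M′ ≢ 0
  M′≢0 M′≡0 = contradiction (trans M≡M′g (cong (_* g) M′≡0)) (>⇒≢ 0<M)

  b⊥M′ : Coprime b M′
  b⊥M′ = noCommonPrime⇒coprime M′≢0 noCommonPrime
    where
    noCommonPrime : ∀ {p} → Prime p → p ∣ b → p ∣ M′ → ⊥
    noCommonPrime {p} p-prime p∣b p∣M′ = contradiction (bounded p (suc n) p-prime (pᵗ∣M (suc n))) (n≮n n)
      where
      pᵗ∣M : ∀ t → p ^ t ∣ M
      pᵗ∣M zero    = 1∣ M
      pᵗ∣M (suc t) = subst (p ^ suc t ∣_) (sym M≡M′g) (*-pres-∣ p∣M′ pᵗ∣g)
        where
        pᵗ∣g : p ^ t ∣ g
        pᵗ∣g = gcd-greatest (∣-trans (^-monoʳ-∣ p (bounded p t p-prime (pᵗ∣M t))) (^-monoˡ-∣ n p∣b))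
                            (pᵗ∣M t)

  g⊥M′ : Coprime g M′
  g⊥M′ (d∣g , d∣M′) = coprime-^ n b⊥M′ (∣-trans d∣g (gcd[m,n]∣m (b ^ n) M) , d∣M′)

  bᵠ≡1 : b ^ φ M ≡ 1 mod M′
  bᵠ≡1 = viaUnitLift (chineseRemainder g⊥M′ 1 b)
    where
    viaUnitLift : (∃ λ b′ → b′ ≡ 1 mod g × b′ ≡ b mod M′) → b ^ φ M ≡ 1 mod M′
    viaUnitLift (b′ , b′≡1 , b′≡b) =
      mod-trans (mod-^ (mod-sym b′≡b) (φ M)) (mod-divisor (divides g M≡gM′) (euler b′⊥M))
      where
      b′⊥M : Coprime b′ M
      b′⊥M = subst (Coprime b′) (sym M≡gM′) (Coprimality.sym
               (coprime-*ˡ (Coprimality.sym (coprime-resp-mod b′≡1 (Coprimality.1-coprimeTo g)))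
                           (Coprimality.sym (coprime-resp-mod b′≡b b⊥M′))))

  bⁿ⁺ᵠ≡bⁿ : b ^ (n + φ M) ≡ b ^ n mod g * M′
  bⁿ⁺ᵠ≡bⁿ = mod-trans (≡⇒≡-mod (begin
      b ^ (n + φ M)        ≡⟨ ^-distribˡ-+-* b n (φ M) ⟩
      b ^ n * b ^ φ M      ≡⟨ cong (_* b ^ φ M) bⁿ≡hg ⟩
      h * g * b ^ φ M      ≡⟨ *-assoc h g _ ⟩
      h * (g * b ^ φ M) ∎))
    (mod-trans (mod-* (mod-refl h) (mod-*ˡ-scale g bᵠ≡1))
    (≡⇒≡-mod (trans (cong (h *_) (*-identityʳ g)) (sym bⁿ≡hg))))

  ^-+φ≡ : b ^ (n + φ M) ≡ b ^ n mod M
  ^-+φ≡ = subst (λ K → b ^ (n + φ M) ≡ b ^ n mod K) (sym M≡gM′) bⁿ⁺ᵠ≡bⁿ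

^-+φ≡ : ∀ {M} b n → 0 < M → ExponentsBoundedBy M n → b ^ (n + φ M) ≡ b ^ n mod M
^-+φ≡ b n 0<M bounded = PowerPeriodicity.^-+φ≡ 0<M b n bounded

powerSumDiff-shift : ∀ {M t d} {u : ℕ → ℕ} → PowerSumDiff u → (∀ b → b ^ (t + d) ≡ b ^ t mod M) →
                     u (t + d) ≡ u t mod M
powerSumDiff-shift {M} {t} {d} {u} (p , q , u+p≡q) shift = mod-cancelʳ-+ (
  mod-trans (mod-+ (mod-refl (u (t + d))) (mod-sym (powerSum-shift p)))
  (mod-trans (≡⇒≡-mod (u+p≡q (t + d)))
  (mod-trans (powerSum-shift q) (≡⇒≡-mod (sym (u+p≡q t))))))
  where
  powerSum-shift : ∀ bs → powerSum bs (t + d) ≡ powerSum bs t mod M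
  powerSum-shift []       = mod-refl 0
  powerSum-shift (b ∷ bs) = mod-+ (shift b) (powerSum-shift bs)

^-+*φ≡ : ∀ {M t} → 0 < M → ExponentsBoundedBy M t → ∀ s b → b ^ (t + s * φ M) ≡ b ^ t mod M
^-+*φ≡ {M} {t} 0<M bounded zero    b = ≡⇒≡-mod (cong (b ^_) (+-identityʳ t))
^-+*φ≡ {M} {t} 0<M bounded (suc s) b =
  mod-trans (≡⇒≡-mod (begin
    b ^ (t + (φ M + s * φ M))      ≡⟨ cong (b ^_) (+-assoc t (φ M) (s * φ M)) ⟨
    b ^ (t + φ M + s * φ M)        ≡⟨ ^-distribˡ-+-* b (t + φ M) (s * φ M) ⟩
    b ^ (t + φ M) * b ^ (s * φ M) ∎))
  (mod-trans (mod-* (^-+φ≡ b t 0<M bounded) (mod-refl (b ^ (s * φ M))))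
  (mod-trans (≡⇒≡-mod (sym (^-distribˡ-+-* b t (s * φ M)))) (^-+*φ≡ 0<M bounded s b)))

powerSumDiff-periodic : ∀ {M t} {u : ℕ → ℕ} → PowerSumDiff u → 0 < M → ExponentsBoundedBy M t →
                        ∀ s → u (t + s * φ M) ≡ u t mod M
powerSumDiff-periodic u-diff 0<M bounded s = powerSumDiff-shift u-diff (^-+*φ≡ 0<M bounded s)

≤∧∣-∣≡⇒≡+ : ∀ {a b k} → a ≤ b → ∣ b - a ∣ ≡ k → b ≡ a + k
≤∧∣-∣≡⇒≡+ {a} a≤b ∣b-a∣≡k =
  trans (sym (m+[n∸m]≡n a≤b)) (cong (a +_) (trans (sym (m≤n⇒∣n-m∣≡n∸m a≤b)) ∣b-a∣≡k))

∣∣-∣⇒multiple : ∀ {d n m} → d ∣ ∣ n - m ∣ → ∃ λ s → n ≡ m + s * d ⊎ m ≡ n + s * d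
∣∣-∣⇒multiple {d} {n} {m} (divides s ∣n-m∣≡sd) with ≤-total m n
... | inj₁ m≤n = s , inj₁ (≤∧∣-∣≡⇒≡+ m≤n ∣n-m∣≡sd)
... | inj₂ n≤m = s , inj₂ (≤∧∣-∣≡⇒≡+ n≤m (trans (∣-∣-comm m n) ∣n-m∣≡sd))

theorem2p3 : (k M : ℕ) → k ≥ 1 → M ≥ 1 →
    (n m : ℕ) → n ≥ 1 → m ≥ 1 →
    -- n, m ≥ max e_j : every exponent e with p^e ∣ M (p prime) is ≤ n and ≤ m
    (∀ p e → Prime p → p ^ e ∣ M → e ≤ n) →
    (∀ p e → Prime p → p ^ e ∣ M → e ≤ m) →
    -- n ≡ m (mod φ(M))
    φ M ∣ ∣ n - m ∣ →
    -- L(k,n) ≡ L(k,m) (mod M)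
    M ∣ ∣ L k n - L k m ∣
theorem2p3 k M _ M≥1 n m _ _ n-bounded m-bounded φM∣∣n-m∣ =
  mod⇒∣ (congruent (∣∣-∣⇒multiple {n = n} {m} φM∣∣n-m∣))
  where
  periodic : ∀ {t} → ExponentsBoundedBy M t → ∀ s → L k (t + s * φ M) ≡ L k t mod M
  periodic = powerSumDiff-periodic (L-powerSumDiff k) M≥1
  congruent : (∃ λ s → n ≡ m + s * φ M ⊎ m ≡ n + s * φ M) → L k n ≡ L k m mod M
  congruent (s , inj₁ n≡m+sφ) = subst (λ t → L k t ≡ L k m mod M) (sym n≡m+sφ) (periodic m-bounded s)
  congruent (s , inj₂ m≡n+sφ) = subst (λ t → L k n ≡ L k t mod M) (sym m≡n+sφ) (mod-sym (periodic n-bounded s))
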